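{- Let $M$ be a matroid on a finite linearly ordered set $E$, and let $p,q$ be non-negative integers. Then $$\frac{\partial^{p+q} t}{\partial x^p\,\partial y^q}(M;x,y)=p!\,q!\sum_{\substack{A\subseteq E\\ cr_M(A)=p,\ nl_M(A)=q}} x^{\iota_M(A)}\,y^{\epsilon_M(A)}.$$
   Context: $r_M$ is the rank function of $M$ and $r(M)=r_M(E)$. The Tutte polynomial is $t(M;x,y)=\sum_{A\subseteq E}(x-1)^{r(M)-r_M(A)}(y-1)^{|A|-r_M(A)}$. For $A\subseteq E$: the corank is $cr_M(A)=r(M)-r_M(A)$ and the nullity is $nl_M(A)=|A|-r_M(A)$. $\mathrm{Ext}_M(A)$ is the set of $e\in E\setminus A$ such that $e$ is the smallest element (in the linear order) of some circuit of $M$ contained in $A\cup\{e\}$, and $\epsilon_M(A)=|\mathrm{Ext}_M(A)|$ (external activity). $\mathrm{Int}_M(A)$ is the set of $e\in A$ such that $e$ is the smallest element of some cocircuit of $M$ contained in $(E\setminus A)\cup\{e\}$, and $\iota_M(A)=|\mathrm{Int}_M(A)|$ (internal activity). -}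

module Defs where

open import Data.Bool using (Bool; true; false; _∧_; _∨_; not; if_then_else_)
open import Data.Nat using (ℕ; zero; suc; _+_; _∸_; _≤_; _≡ᵇ_; _<ᵇ_; _≤ᵇ_)
open import Data.Nat.Combinatorics.Base using () renaming (_P_ to _falling_)
open import Data.Integer using (ℤ; +_; -[1+_]) renaming (_*_ to _*ℤ_; _+_ to _+ℤ_)
open import Data.Fin using (Fin; toℕ)
open import Data.Fin.Subset using (Subset; ⊤; ⁅_⁆; ∁; _∩_; _∪_; _⊆_; ∣_∣; inside; outside)
open import Data.Vec using (Vec; []; _∷_; lookup)
open import Data.List using (List; []; _∷_; [_]; _++_; map; concatMap; filterᵇ; length; allFin; foldr)
open import Data.Bool.ListAction using (all; any)
open import Data.Product using (_×_; _,_)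
open import Relation.Binary.PropositionalEquality using (_≡_)

-- Matroids on the linearly ordered ground set E = Fin n (order = order of Fin),
-- given by their rank function (rank axioms R1–R3, Oxley).

record Matroid (n : ℕ) : Set where
  field
    r          : Subset n → ℕ
    r-bounded  : ∀ A → r A ≤ ∣ A ∣
    r-mono     : ∀ {A B} → A ⊆ B → r A ≤ r B
    r-submod   : ∀ A B → r (A ∪ B) + r (A ∩ B) ≤ r A + r B

open Matroid public

rankM : ∀ {n} → Matroid n → ℕ
rankM M = r M ⊤

cr : ∀ {n} → Matroid n → Subset n → ℕ
cr M A = rankM M ∸ r M A

nl : ∀ {n} → Matroid n → Subset n → ℕ
nl M A = ∣ A ∣ ∸ r M A

allSubsets : ∀ n → List (Subset n)
allSubsets zero    = [ [] ]
allSubsets (suc n) = map (outside ∷_) (allSubsets n) ++ map (inside ∷_) (allSubsets n)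

_∈ᵇ_ : ∀ {n} → Fin n → Subset n → Bool
e ∈ᵇ A = lookup A e

_⊆ᵇ_ : ∀ {n} → Subset n → Subset n → Bool
_⊆ᵇ_ {n} A B = all (λ e → not (e ∈ᵇ A) ∨ (e ∈ᵇ B)) (allFin n)

_⊂ᵇ_ : ∀ {n} → Subset n → Subset n → Bool
D ⊂ᵇ C = (D ⊆ᵇ C) ∧ (∣ D ∣ <ᵇ ∣ C ∣)

isCircuitFor : ∀ {n} → (Subset n → ℕ) → Subset n → Bool
isCircuitFor {n} rk C =
  (rk C <ᵇ ∣ C ∣) ∧ all (λ D → not (D ⊂ᵇ C) ∨ (rk D ≡ᵇ ∣ D ∣)) (allSubsets n)

isCircuit : ∀ {n} → Matroid n → Subset n → Bool
isCircuit M = isCircuitFor (r M)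

dualRank : ∀ {n} → Matroid n → Subset n → ℕ
dualRank M A = (∣ A ∣ + r M (∁ A)) ∸ rankM M

isCocircuit : ∀ {n} → Matroid n → Subset n → Bool
isCocircuit M = isCircuitFor (dualRank M)

isSmallestOf : ∀ {n} → Fin n → Subset n → Bool
isSmallestOf {n} e C = (e ∈ᵇ C) ∧ all (λ i → not (i ∈ᵇ C) ∨ (toℕ e ≤ᵇ toℕ i)) (allFin n)

inExt : ∀ {n} → Matroid n → Subset n → Fin n → Bool
inExt {n} M A e = not (e ∈ᵇ A) ∧
  any (λ C → isCircuit M C ∧ (C ⊆ᵇ (A ∪ ⁅ e ⁆)) ∧ isSmallestOf e C) (allSubsets n)

inInt : ∀ {n} → Matroid n → Subset n → Fin n → Bool
inInt {n} M A e = (e ∈ᵇ A) ∧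
  any (λ C → isCocircuit M C ∧ (C ⊆ᵇ (∁ A ∪ ⁅ e ⁆)) ∧ isSmallestOf e C) (allSubsets n)

ε : ∀ {n} → Matroid n → Subset n → ℕ
ε {n} M A = length (filterᵇ (inExt M A) (allFin n))

ι : ∀ {n} → Matroid n → Subset n → ℕ
ι {n} M A = length (filterᵇ (inInt M A) (allFin n))

-- Bivariate polynomials over ℤ, as finite formal sums of terms c·x^i·y^j.

Poly : Set
Poly = List (ℤ × ℕ × ℕ)

coeff : Poly → ℕ → ℕ → ℤ
coeff []                  i j = + 0
coeff ((c , a , b) ∷ Ps)  i j =
  (if (a ≡ᵇ i) ∧ (b ≡ᵇ j) then c else + 0) +ℤ coeff Ps i j

_≈ₚ_ : Poly → Poly → Set
P ≈ₚ Q = ∀ i j → coeff P i j ≡ coeff Q i j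

constₚ : ℤ → Poly
constₚ c = [ (c , 0 , 0) ]

Xₚ Yₚ : Poly
Xₚ = [ (+ 1 , 1 , 0) ]
Yₚ = [ (+ 1 , 0 , 1) ]

_⊕_ : Poly → Poly → Poly
P ⊕ Q = P ++ Q

_⊗_ : Poly → Poly → Poly
P ⊗ Q = concatMap (λ { (c , a , b) → map (λ { (d , a′ , b′) → (c *ℤ d , a + a′ , b + b′) }) Q }) P

_^ₚ_ : Poly → ℕ → Poly
P ^ₚ zero  = constₚ (+ 1)
P ^ₚ suc k = P ⊗ (P ^ₚ k)

scaleₚ : ℤ → Poly → Poly
scaleₚ c P = constₚ c ⊗ P

sumₚ : List Poly → Poly
sumₚ = foldr _⊕_ []

-- ∂^{p+q} / ∂x^p ∂y^q, termwise:  x^a y^b ↦ (a falling p)(b falling q) x^(a-p) y^(b-q)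
-- (a falling p = a!/(a-p)! is 0 when p > a)
∂ : ℕ → ℕ → Poly → Poly
∂ p q = map (λ { (c , a , b) → (c *ℤ (+ (a falling p)) *ℤ (+ (b falling q)) , a ∸ p , b ∸ q) })

tutte : ∀ {n} → Matroid n → Poly
tutte {n} M = sumₚ (map (λ A → ((Xₚ ⊕ constₚ -[1+ 0 ]) ^ₚ cr M A) ⊗ ((Yₚ ⊕ constₚ -[1+ 0 ]) ^ₚ nl M A))
                        (allSubsets n))

activitySum : ∀ {n} → Matroid n → ℕ → ℕ → Poly
activitySum {n} M p q =
  sumₚ (map (λ A → [ (+ 1 , ι M A , ε M A) ])
            (filterᵇ (λ A → (cr M A ≡ᵇ p) ∧ (nl M A ≡ᵇ q)) (allSubsets n)))

module Submission where

-- We compare coefficients of x^i y^j.  With κ a p i the coefficient of z^i in the p-th derivative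
-- of (z - 1)^a, the left side is Σ_A κ (cr A) p i · κ (nl A) q j, and the right side is p! q! times
-- the number of subsets A whose profile (cr A, nl A, ι A, ε A) equals (p, q, i, j).  Both are sums
-- of a weight over the profiles of all subsets; they agree by induction on |E|, splitting off the
-- largest element e.  If e is a coloop, the profiles of M are those of M \ e with the corank
-- (e ∉ A) or the internal activity (e ∈ A) raised by one, and the identity follows from
-- (z - 1)^(a+1) + (z - 1)^a = z (z - 1)^a and Leibniz' rule; a loop is the mirror image under
-- cr ↔ nl, ι ↔ ε; otherwise the profiles of M are those of M \ e together with those of M / e.

module Enumeration where

  open import Defs
  open import Data.Bool using (Bool; true; false; T; not; _∨_)
  open import Data.Unit using (tt)
  open import Function.Bundles using (_⇔_; mk⇔; Equivalence)
  open import Data.Bool.Properties using (T-≡)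
  open import Data.Empty using (⊥-elim)
  open import Data.Bool.ListAction using (all; any)
  open import Data.Nat using (ℕ; zero; suc; _+_; _≡ᵇ_)
  import Data.Nat.Properties as NP
  open import Data.Nat.Tactic.RingSolver using (solve-∀)
  open import Data.Fin using (Fin; inject₁; fromℕ)
  import Data.Fin as F
  open import Data.Fin.Subset using (Subset; inside; outside)
  open import Data.Vec using ([]; _∷_)
  open import Data.List using (List; []; _∷_; map; length; filterᵇ; allFin; tabulate)
  open import Data.List.Membership.Propositional using (_∈_; lose)
  import Data.List.Membership.Propositional.Properties as LMP
  open import Data.List.Relation.Unary.Any using (here; satisfied)
  import Data.List.Relation.Unary.Any.Properties as AnyP
  import Data.List.Relation.Unary.All as All
  import Data.List.Relation.Unary.All.Properties as AllP
  open import Data.Product using (∃)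
  open import Function using (_∘_; id)
  open import Relation.Binary.PropositionalEquality

  T-ext : ∀ {a b} → (T a → T b) → (T b → T a) → a ≡ b
  T-ext {false} {false} _ _ = refl
  T-ext {false} {true}  _ g = ⊥-elim (g tt)
  T-ext {true}  {false} f _ = ⊥-elim (f tt)
  T-ext {true}  {true}  _ _ = refl

  implication-reflect : ∀ {a b} → T (not a ∨ b) ⇔ (T a → T b)
  implication-reflect {true}  = mk⇔ (λ t _ → t) (λ f → f tt)
  implication-reflect {false} = mk⇔ (λ _ ()) (λ _ → tt)

  ≡ᵇ-cong : ∀ {a b c d : ℕ} → (a ≡ b → c ≡ d) → (c ≡ d → a ≡ b) → (a ≡ᵇ b) ≡ (c ≡ᵇ d)
  ≡ᵇ-cong {a} {b} {c} {d} f g =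
    T-ext (NP.≡⇒≡ᵇ c d ∘ f ∘ NP.≡ᵇ⇒≡ a b) (NP.≡⇒≡ᵇ a b ∘ g ∘ NP.≡ᵇ⇒≡ c d)

  ≡⇒≡ᵇ-true : ∀ {m n} → m ≡ n → (m ≡ᵇ n) ≡ true
  ≡⇒≡ᵇ-true {m} {n} m≡n = Equivalence.to T-≡ (NP.≡⇒≡ᵇ m n m≡n)

  ≢⇒≡ᵇ-false : ∀ {m n} → m ≢ n → (m ≡ᵇ n) ≡ false
  ≢⇒≡ᵇ-false {m} {n} m≢n with m ≡ᵇ n in eq
  ... | false = refl
  ... | true  = ⊥-elim (m≢n (NP.≡ᵇ⇒≡ m n (subst T (sym eq) tt)))

  ∈-allSubsets : ∀ {n} (A : Subset n) → A ∈ allSubsets n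
  ∈-allSubsets []               = here refl
  ∈-allSubsets {suc n} (outside ∷ A) =
    LMP.∈-++⁺ˡ (LMP.∈-map⁺ (outside ∷_) (∈-allSubsets A))
  ∈-allSubsets {suc n} (inside ∷ A)  =
    LMP.∈-++⁺ʳ (map (outside ∷_) (allSubsets n)) (LMP.∈-map⁺ (inside ∷_) (∈-allSubsets A))

  module Complete {X : Set} (xs : List X) (complete : ∀ x → x ∈ xs) (p : X → Bool) where

    all-elim : T (all p xs) → ∀ x → T (p x)
    all-elim h x = All.lookup (AllP.all⁺ p xs h) (complete x)

    all-intro : (∀ x → T (p x)) → T (all p xs)
    all-intro h = AllP.all⁻ p {xs} (All.tabulate λ {x} _ → h x)

    any-elim : T (any p xs) → ∃ λ x → T (p x)
    any-elim h = satisfied (AnyP.any⁻ p xs h)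

    any-intro : ∀ x → T (p x) → T (any p xs)
    any-intro x h = AnyP.any⁺ p (lose (complete x) h)

  ind : Bool → ℕ
  ind true  = 1
  ind false = 0

  count : ∀ n → (Fin n → Bool) → ℕ
  count zero    P = 0
  count (suc n) P = ind (P F.zero) + count n (P ∘ F.suc)

  length-filter-tabulate : ∀ {X : Set} n (P : X → Bool) (g : Fin n → X) →
                           length (filterᵇ P (tabulate g)) ≡ count n (P ∘ g)
  length-filter-tabulate zero    P g = refl
  length-filter-tabulate (suc n) P g with P (g F.zero)
  ... | true  = cong suc (length-filter-tabulate n P (g ∘ F.suc))
  ... | false = length-filter-tabulate n P (g ∘ F.suc)

  length-filter-allFin : ∀ n (P : Fin n → Bool) → length (filterᵇ P (allFin n)) ≡ count n P
  length-filter-allFin n P = length-filter-tabulate n P id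

  count-cong : ∀ n {P Q : Fin n → Bool} → (∀ x → P x ≡ Q x) → count n P ≡ count n Q
  count-cong zero    eq = refl
  count-cong (suc n) eq = cong₂ _+_ (cong ind (eq F.zero)) (count-cong n (eq ∘ F.suc))

  count-last : ∀ n (P : Fin (suc n) → Bool) → count (suc n) P ≡ ind (P (fromℕ n)) + count n (P ∘ inject₁)
  count-last zero    P = refl
  count-last (suc n) P = begin
    first + count (suc n) (P ∘ F.suc)   ≡⟨ cong (first +_) (count-last n (P ∘ F.suc)) ⟩
    first + (last + rest)               ≡⟨ swap-front first last rest ⟩
    last + (first + rest)               ∎
    where
    open ≡-Reasoning
    first = ind (P F.zero)
    last  = ind (P (fromℕ (suc n)))
    rest  = count n (P ∘ F.suc ∘ inject₁)
    swap-front : ∀ a b c → a + (b + c) ≡ b + (a + c)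
    swap-front = solve-∀

module Subsets where

  open import Data.Bool using (true; _∧_; _∨_; not; T)
  open import Data.Nat using (zero; suc; _+_; _<_; _<ᵇ_)
  import Data.Nat.Properties as NP
  open import Data.Fin using (Fin; toℕ; inject₁; fromℕ)
  import Data.Fin as F
  open import Data.Fin.Subset
    using (Subset; ⊤; ⁅_⁆; ∁; _∩_; _∪_; _-_; _⊆_; ∣_∣; inside; outside; _∈_; _∉_)
    renaming (⊥ to ∅)
  import Data.Fin.Subset.Properties as SP
  open import Data.Vec using (Vec; []; _∷_; _∷ʳ_; lookup; zipWith; replicate)
  import Data.Vec.Properties as VP
  open import Data.Vec.Base using (here; there)
  open import Function using (_∘′_)
  import Data.Fin.Properties as FP
  open import Data.Product using (∃; _×_; _,_)
  open import Data.Sum using (inj₁; inj₂)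
  open import Relation.Nullary using (¬?; yes; no)
  open import Relation.Nullary.Decidable using (_×-dec_)
  open import Data.Unit using (tt)
  open import Data.Empty using (⊥-elim)
  open import Relation.Binary.PropositionalEquality

  ∈⇒T : ∀ {n} {p : Subset n} {x} → x ∈ p → T (lookup p x)
  ∈⇒T x∈p = subst T (sym (VP.[]=⇒lookup x∈p)) tt

  T⇒∈ : ∀ {n} {p : Subset n} {x} → T (lookup p x) → x ∈ p
  T⇒∈ {p = p} {x} t with lookup p x in eq
  ... | true = VP.lookup⇒[]= x p eq

  x∈p-y⇒x≢y : ∀ {n} (p : Subset n) {x y} → x ∈ p - y → x ≢ y
  x∈p-y⇒x≢y p x∈ refl = not-removed p _ x∈
    where
    not-removed : ∀ {n} (p : Subset n) x → x ∉ p - x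
    not-removed (s ∷ p) F.zero    ()
    not-removed (s ∷ p) (F.suc x) (there m) = not-removed p x m

  ∁-∪ : ∀ {n} (p q : Subset n) → ∁ (p ∪ q) ≡ ∁ p ∩ ∁ q
  ∁-∪ []            []            = refl
  ∁-∪ (inside ∷ p)  (b ∷ q)       = cong (outside ∷_) (∁-∪ p q)
  ∁-∪ (outside ∷ p) (b ∷ q)       = cong (not b ∷_) (∁-∪ p q)

  ∁-∩ : ∀ {n} (p q : Subset n) → ∁ (p ∩ q) ≡ ∁ p ∪ ∁ q
  ∁-∩ []            []            = refl
  ∁-∩ (inside ∷ p)  (b ∷ q)       = cong (not b ∷_) (∁-∩ p q)
  ∁-∩ (outside ∷ p) (b ∷ q)       = cong (inside ∷_) (∁-∩ p q)

  ∪-monoˡ : ∀ {n} {p q : Subset n} (s : Subset n) → p ⊆ q → p ∪ s ⊆ q ∪ s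
  ∪-monoˡ {p = p} s p⊆q x∈ with SP.x∈p∪q⁻ p s x∈
  ... | inj₁ x∈p = SP.x∈p∪q⁺ (inj₁ (p⊆q x∈p))
  ... | inj₂ x∈s = SP.x∈p∪q⁺ (inj₂ x∈s)

  card-cong : ∀ {n} {p q : Subset n} → p ⊆ q → q ⊆ p → ∣ p ∣ ≡ ∣ q ∣
  card-cong p⊆q q⊆p = NP.≤-antisym (SP.p⊆q⇒∣p∣≤∣q∣ p⊆q) (SP.p⊆q⇒∣p∣≤∣q∣ q⊆p)

  card-split : ∀ {n} (p q : Subset n) → ∣ p ∩ q ∣ + ∣ p ∩ ∁ q ∣ ≡ ∣ p ∣
  card-split []           []           = refl
  card-split (inside ∷ p)  (inside ∷ q)  = cong suc (card-split p q)
  card-split (inside ∷ p)  (outside ∷ q) = trans (NP.+-suc _ _) (cong suc (card-split p q))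
  card-split (outside ∷ p) (inside ∷ q)  = card-split p q
  card-split (outside ∷ p) (outside ∷ q) = card-split p q

  card-union : ∀ {n} (p q : Subset n) → ∣ p ∪ q ∣ + ∣ p ∩ q ∣ ≡ ∣ p ∣ + ∣ q ∣
  card-union []            []            = refl
  card-union (inside ∷ p)  (inside ∷ q)  =
    cong suc (trans (NP.+-suc _ _) (trans (cong suc (card-union p q)) (sym (NP.+-suc _ _))))
  card-union (inside ∷ p)  (outside ∷ q) = cong suc (card-union p q)
  card-union (outside ∷ p) (inside ∷ q)  = trans (cong suc (card-union p q)) (sym (NP.+-suc _ _))
  card-union (outside ∷ p) (outside ∷ q) = card-union p q

  smaller-subset-misses : ∀ {n} {p q : Subset n} → p ⊆ q → ∣ p ∣ < ∣ q ∣ → ∃ λ x → x ∈ q × x ∉ p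
  smaller-subset-misses {p = p} {q} p⊆q ∣p∣<∣q∣
    with FP.any? (λ x → x SP.∈? q ×-dec ¬? (x SP.∈? p))
  ... | yes witness = witness
  ... | no  none    = ⊥-elim (NP.<⇒≱ ∣p∣<∣q∣ (SP.p⊆q⇒∣p∣≤∣q∣ q⊆p))
    where
    q⊆p : q ⊆ p
    q⊆p {x} x∈q with x SP.∈? p
    ... | yes x∈p = x∈p
    ... | no  x∉p = ⊥-elim (none (x , x∈q , x∉p))

  card-remove : ∀ {n} (p : Subset n) {x} → x ∈ p → suc ∣ p - x ∣ ≡ ∣ p ∣
  card-remove (inside ∷ p)  {F.zero}  _ = cong suc (cong ∣_∣ (SP.p─⊥≡p p))
  card-remove (inside ∷ p)  {F.suc x} m = cong suc (card-remove p (SP.drop-there m))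
  card-remove (outside ∷ p) {F.suc x} m = card-remove p (SP.drop-there m)

  card-insert : ∀ {n} (p : Subset n) {x} → x ∉ p → ∣ p ∪ ⁅ x ⁆ ∣ ≡ suc ∣ p ∣
  card-insert (inside ∷ p)  {F.zero}  x∉ = ⊥-elim (x∉ here)
  card-insert (outside ∷ p) {F.zero}  _  = cong suc (cong ∣_∣ (SP.∪-identityʳ p))
  card-insert (inside ∷ p)  {F.suc x} x∉ = cong suc (card-insert p (x∉ ∘′ there))
  card-insert (outside ∷ p) {F.suc x} x∉ = card-insert p (x∉ ∘′ there)

  -- A subset of Fin (suc n) is written A ∷ʳ b, where b decides the largest element.

  module _ {A : Set} where

    zipWith-∷ʳ : ∀ {n} (f : A → A → A) (xs ys : Vec A n) x y →
                 zipWith f (xs ∷ʳ x) (ys ∷ʳ y) ≡ zipWith f xs ys ∷ʳ f x y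
    zipWith-∷ʳ f []       []       x y = refl
    zipWith-∷ʳ f (a ∷ xs) (b ∷ ys) x y = cong (f a b ∷_) (zipWith-∷ʳ f xs ys x y)

    replicate-∷ʳ : ∀ n (x : A) → replicate (suc n) x ≡ replicate n x ∷ʳ x
    replicate-∷ʳ zero    x = refl
    replicate-∷ʳ (suc n) x = cong (x ∷_) (replicate-∷ʳ n x)

    lookup-∷ʳ-inject₁ : ∀ {n} (xs : Vec A n) x i → lookup (xs ∷ʳ x) (inject₁ i) ≡ lookup xs i
    lookup-∷ʳ-inject₁ (a ∷ xs) x F.zero    = refl
    lookup-∷ʳ-inject₁ (a ∷ xs) x (F.suc i) = lookup-∷ʳ-inject₁ xs x i

    lookup-∷ʳ-last : ∀ {n} (xs : Vec A n) x → lookup (xs ∷ʳ x) (fromℕ n) ≡ x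
    lookup-∷ʳ-last []       x = refl
    lookup-∷ʳ-last (a ∷ xs) x = lookup-∷ʳ-last xs x

  ∪-∷ʳ : ∀ {n} (p q : Subset n) a b → (p ∷ʳ a) ∪ (q ∷ʳ b) ≡ (p ∪ q) ∷ʳ (a ∨ b)
  ∪-∷ʳ = zipWith-∷ʳ _∨_

  ∩-∷ʳ : ∀ {n} (p q : Subset n) a b → (p ∷ʳ a) ∩ (q ∷ʳ b) ≡ (p ∩ q) ∷ʳ (a ∧ b)
  ∩-∷ʳ = zipWith-∷ʳ _∧_

  ∁-∷ʳ : ∀ {n} (p : Subset n) a → ∁ (p ∷ʳ a) ≡ ∁ p ∷ʳ not a
  ∁-∷ʳ p a = VP.map-∷ʳ not a p

  ⊤-∷ʳ : ∀ n → ⊤ {suc n} ≡ ⊤ {n} ∷ʳ inside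
  ⊤-∷ʳ n = replicate-∷ʳ n inside

  ∅-∷ʳ : ∀ n → ∅ {suc n} ≡ ∅ {n} ∷ʳ outside
  ∅-∷ʳ n = replicate-∷ʳ n outside

  ⁅inject₁⁆ : ∀ {n} (e : Fin n) → ⁅ inject₁ e ⁆ ≡ ⁅ e ⁆ ∷ʳ outside
  ⁅inject₁⁆ {suc n} F.zero    = cong (inside ∷_) (∅-∷ʳ n)
  ⁅inject₁⁆         (F.suc e) = cong (outside ∷_) (⁅inject₁⁆ e)

  ⁅last⁆ : ∀ n → ⁅ fromℕ n ⁆ ≡ ∅ {n} ∷ʳ inside
  ⁅last⁆ zero    = refl
  ⁅last⁆ (suc n) = cong (outside ∷_) (⁅last⁆ n)

  card-∷ʳ-inside : ∀ {n} (p : Subset n) → ∣ p ∷ʳ inside ∣ ≡ suc ∣ p ∣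
  card-∷ʳ-inside []            = refl
  card-∷ʳ-inside (inside ∷ p)  = cong suc (card-∷ʳ-inside p)
  card-∷ʳ-inside (outside ∷ p) = card-∷ʳ-inside p

  card-∷ʳ-outside : ∀ {n} (p : Subset n) → ∣ p ∷ʳ outside ∣ ≡ ∣ p ∣
  card-∷ʳ-outside []            = refl
  card-∷ʳ-outside (inside ∷ p)  = cong suc (card-∷ʳ-outside p)
  card-∷ʳ-outside (outside ∷ p) = card-∷ʳ-outside p

  ∷ʳ-⊆ : ∀ {n} {p q : Subset n} {a b} → (a ≡ inside → b ≡ inside) → p ⊆ q → (p ∷ʳ a) ⊆ (q ∷ʳ b)
  ∷ʳ-⊆ {p = []}    {[]}    a⇒b _   here rewrite a⇒b refl = here
  ∷ʳ-⊆ {p = x ∷ p} {y ∷ q} a⇒b p⊆q here with p⊆q here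
  ... | here = here
  ∷ʳ-⊆ {p = x ∷ p} {y ∷ q} a⇒b p⊆q (there m) =
    there (∷ʳ-⊆ a⇒b (SP.drop-∷-⊆ p⊆q) m)

  above : ∀ {n} → Fin n → Subset n
  above F.zero    = outside ∷ ⊤
  above (F.suc e) = outside ∷ above e

  lookup-above : ∀ {n} (e i : Fin n) → lookup (above e) i ≡ (toℕ e <ᵇ toℕ i)
  lookup-above F.zero    F.zero    = refl
  lookup-above F.zero    (F.suc i) = VP.lookup-replicate i inside
  lookup-above (F.suc e) F.zero    = refl
  lookup-above (F.suc e) (F.suc i) = lookup-above e i

  ∈-above⁺ : ∀ {n} {e i : Fin n} → toℕ e < toℕ i → i ∈ above e
  ∈-above⁺ {e = e} {i} e<i = T⇒∈ (subst T (sym (lookup-above e i)) (NP.<⇒<ᵇ e<i))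

  ∈-above⁻ : ∀ {n} {e i : Fin n} → i ∈ above e → toℕ e < toℕ i
  ∈-above⁻ {e = e} {i} i∈ = NP.<ᵇ⇒< (toℕ e) (toℕ i) (subst T (lookup-above e i) (∈⇒T i∈))

  above-inject₁ : ∀ {n} (e : Fin n) → above (inject₁ e) ≡ above e ∷ʳ inside
  above-inject₁ {suc n} F.zero    = cong (outside ∷_) (⊤-∷ʳ n)
  above-inject₁         (F.suc e) = cong (outside ∷_) (above-inject₁ e)

  above-last : ∀ n → above (fromℕ n) ≡ ∅
  above-last zero    = refl
  above-last (suc n) = cong (outside ∷_) (above-last n)

module Circuits where

  open import Defs
  open Subsets
  open import Data.Nat using (zero; suc; _+_; _≤_; _<_; z<s)
  import Data.Nat.Properties as NP
  open import Data.Fin using (Fin)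
  import Data.Fin.Properties as FP
  open import Data.Fin.Subset
    using (Subset; ⁅_⁆; ∁; _∩_; _∪_; _-_; _⊆_; ∣_∣; _∈_; _∉_) renaming (⊥ to ∅)
  import Data.Fin.Subset.Properties as SP
  open import Data.Product using (∃; _×_; _,_; proj₁; proj₂)
  open import Data.Sum using (inj₁; inj₂)
  open import Data.Empty using (⊥-elim)
  open import Function using (_∘_)
  open import Relation.Nullary using (yes; no)
  open import Relation.Nullary.Decidable using (_×-dec_)
  open import Relation.Binary.PropositionalEquality

  <-transfer : ∀ {a b c d} → a + b ≤ c + d → c < a → b < d
  <-transfer {a} {b} {c} {d} le c<a = NP.+-cancelˡ-≤ c (suc b) d
    (NP.≤-trans (NP.≤-reflexive (NP.+-suc c b)) (NP.≤-trans (NP.+-monoˡ-≤ b c<a) le))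

  ∈-remove⁻ : ∀ {n} {S : Subset n} {s x} → x ∈ S - s → x ∈ S × x ≢ s
  ∈-remove⁻ {S = S} {s} x∈ = SP.p─q⊆p S ⁅ s ⁆ x∈ , x∈p-y⇒x≢y S x∈

  module RankFacts {n} (M : Matroid n) where
    open Matroid M using () renaming (r to rk; r-bounded to bounded; r-mono to mono; r-submod to submod)

    r-cong : ∀ {A B} → A ⊆ B → B ⊆ A → rk A ≡ rk B
    r-cong A⊆B B⊆A = NP.≤-antisym (mono A⊆B) (mono B⊆A)

    r-subadditive : ∀ A B → rk (A ∪ B) ≤ rk A + rk B
    r-subadditive A B = NP.≤-trans (NP.m≤m+n _ _) (submod A B)

    r-insert : ∀ A e → rk (A ∪ ⁅ e ⁆) ≤ suc (rk A)
    r-insert A e = begin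
      rk (A ∪ ⁅ e ⁆)   ≤⟨ r-subadditive A ⁅ e ⁆ ⟩
      rk A + rk ⁅ e ⁆  ≤⟨ NP.+-monoʳ-≤ (rk A) (bounded ⁅ e ⁆) ⟩
      rk A + ∣ ⁅ e ⁆ ∣ ≡⟨ cong (rk A +_) (SP.∣⁅x⁆∣≡1 e) ⟩
      rk A + 1         ≡⟨ NP.+-comm (rk A) 1 ⟩
      suc (rk A)       ∎
      where open NP.≤-Reasoning

    r-empty : ∀ {Z} → Z ⊆ ∅ → rk Z ≡ 0
    r-empty {Z} Z⊆∅ = NP.n≤0⇒n≡0 (begin
      rk Z    ≤⟨ bounded Z ⟩
      ∣ Z ∣   ≤⟨ SP.p⊆q⇒∣p∣≤∣q∣ Z⊆∅ ⟩
      ∣ ∅ {n} ∣ ≡⟨ SP.∣⊥∣≡0 n ⟩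
      0       ∎)
      where open NP.≤-Reasoning

    Independent : Subset n → Set
    Independent I = rk I ≡ ∣ I ∣

    independent-⊆ : ∀ {D I} → D ⊆ I → Independent I → Independent D
    independent-⊆ {D} {I} D⊆I indep-I =
      NP.≤-antisym (bounded D) (NP.+-cancelʳ-≤ ∣ W ∣ ∣ D ∣ (rk D) chain)
      where
      W = I ∩ ∁ D
      I⊆D∪W : I ⊆ D ∪ W
      I⊆D∪W {x} x∈I with x SP.∈? D
      ... | yes x∈D = SP.x∈p∪q⁺ (inj₁ x∈D)
      ... | no  x∉D = SP.x∈p∪q⁺ (inj₂ (SP.x∈p∩q⁺ (x∈I , SP.x∉p⇒x∈∁p x∉D)))
      chain : ∣ D ∣ + ∣ W ∣ ≤ rk D + ∣ W ∣
      chain = begin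
        ∣ D ∣ + ∣ W ∣     ≡⟨ cong (_+ ∣ W ∣) (card-cong (λ m → SP.x∈p∩q⁺ (D⊆I m , m)) (SP.p∩q⊆q I D)) ⟩
        ∣ I ∩ D ∣ + ∣ W ∣ ≡⟨ card-split I D ⟩
        ∣ I ∣             ≡⟨ sym indep-I ⟩
        rk I              ≤⟨ mono I⊆D∪W ⟩
        rk (D ∪ W)        ≤⟨ r-subadditive D W ⟩
        rk D + rk W       ≤⟨ NP.+-monoʳ-≤ (rk D) (bounded W) ⟩
        rk D + ∣ W ∣      ∎
        where open NP.≤-Reasoning

    Critical : Subset n → Set
    Critical S = ∀ {s} → s ∈ S → rk (S - s) < rk S

    critical-remove : ∀ {S s} → Critical S → s ∈ S → Critical (S - s)
    critical-remove {S} {s} critical s∈S {t} t∈S-s = <-transfer le (critical t∈S)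
      where
      t∈S = proj₁ (∈-remove⁻ t∈S-s)
      t≢s = proj₂ (∈-remove⁻ t∈S-s)
      S⊆ : S ⊆ (S - t) ∪ (S - s)
      S⊆ {x} x∈S with x FP.≟ t
      ... | yes refl = SP.x∈p∪q⁺ (inj₂ (SP.x∈p∧x≢y⇒x∈p-y x∈S t≢s))
      ... | no  x≢t  = SP.x∈p∪q⁺ (inj₁ (SP.x∈p∧x≢y⇒x∈p-y x∈S x≢t))
      ⊆∩ : (S - s) - t ⊆ (S - t) ∩ (S - s)
      ⊆∩ x∈ = let x∈S-s , x≢t = ∈-remove⁻ x∈ in
              SP.x∈p∩q⁺ (SP.x∈p∧x≢y⇒x∈p-y (proj₁ (∈-remove⁻ x∈S-s)) x≢t , x∈S-s)
      le : rk S + rk ((S - s) - t) ≤ rk (S - t) + rk (S - s)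
      le = NP.≤-trans (NP.+-mono-≤ (mono S⊆) (mono ⊆∩)) (submod (S - t) (S - s))

    independent-if-critical : ∀ S → Critical S → Independent S
    independent-if-critical S = go ∣ S ∣ S refl
      where
      go : ∀ k S → ∣ S ∣ ≡ k → Critical S → Independent S
      go zero    S ∣S∣≡0 _ = trans (NP.n≤0⇒n≡0 (subst (rk S ≤_) ∣S∣≡0 (bounded S))) (sym ∣S∣≡0)
      go (suc k) S ∣S∣≡1+k critical =
        NP.≤-antisym (bounded S) (subst (_≤ rk S) (sym ∣S∣≡1+k) (subst (λ m → suc m ≤ rk S) rk-S-s (critical s∈S)))
        where
        nonempty = smaller-subset-misses (SP.⊆-min S) (subst₂ _<_ (sym (SP.∣⊥∣≡0 n)) (sym ∣S∣≡1+k) z<s)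
        s = proj₁ nonempty
        s∈S = proj₁ (proj₂ nonempty)
        ∣S-s∣≡k : ∣ S - s ∣ ≡ k
        ∣S-s∣≡k = NP.suc-injective (trans (card-remove S s∈S) ∣S∣≡1+k)
        rk-S-s : rk (S - s) ≡ k
        rk-S-s = trans (go k (S - s) ∣S-s∣≡k (critical-remove critical s∈S)) ∣S-s∣≡k

    IsCircuit : Subset n → Set
    IsCircuit C = rk C < ∣ C ∣ × (∀ D → D ⊆ C → ∣ D ∣ < ∣ C ∣ → Independent D)

    circuit-spans : ∀ {C X e} → IsCircuit C → e ∈ C → C ⊆ X ∪ ⁅ e ⁆ → rk (X ∪ ⁅ e ⁆) ≡ rk X
    circuit-spans {C} {X} {e} (dependent , proper-indep) e∈C C⊆X+e =
      NP.≤-antisym (NP.+-cancelʳ-≤ (rk C') _ _ le) (mono (SP.p⊆p∪q ⁅ e ⁆))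
      where
      C' = C - e
      ∣C∣≡ : suc ∣ C' ∣ ≡ ∣ C ∣
      ∣C∣≡ = card-remove C e∈C
      indep-C' : Independent C'
      indep-C' = proper-indep C' (SP.p─q⊆p C ⁅ e ⁆) (subst (∣ C' ∣ <_) ∣C∣≡ (NP.n<1+n _))
      rk-C≤ : rk C ≤ rk C'
      rk-C≤ = subst (rk C ≤_) (sym indep-C') (NP.≤-pred (subst (rk C <_) (sym ∣C∣≡) dependent))
      ∪⊆ : X ∪ ⁅ e ⁆ ⊆ X ∪ C
      ∪⊆ m with SP.x∈p∪q⁻ X ⁅ e ⁆ m
      ... | inj₁ x∈X = SP.x∈p∪q⁺ (inj₁ x∈X)
      ... | inj₂ x∈e = SP.x∈p∪q⁺ (inj₂ (subst (_∈ C) (sym (SP.x∈⁅y⁆⇒x≡y e x∈e)) e∈C))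
      ⊆∩ : C' ⊆ X ∩ C
      ⊆∩ m with ∈-remove⁻ m
      ... | x∈C , x≢e with SP.x∈p∪q⁻ X ⁅ e ⁆ (C⊆X+e x∈C)
      ...   | inj₁ x∈X = SP.x∈p∩q⁺ (x∈X , x∈C)
      ...   | inj₂ x∈e = ⊥-elim (x≢e (SP.x∈⁅y⁆⇒x≡y e x∈e))
      le : rk (X ∪ ⁅ e ⁆) + rk C' ≤ rk X + rk C'
      le = begin
        rk (X ∪ ⁅ e ⁆) + rk C'   ≤⟨ NP.+-mono-≤ (mono ∪⊆) (mono ⊆∩) ⟩
        rk (X ∪ C) + rk (X ∩ C)  ≤⟨ submod X C ⟩
        rk X + rk C              ≤⟨ NP.+-monoʳ-≤ (rk X) rk-C≤ ⟩
        rk X + rk C'             ∎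
        where open NP.≤-Reasoning

    Minimal : Fin n → Subset n → Set
    Minimal e S = ∀ {s} → s ∈ S → rk ((S - s) ∪ ⁅ e ⁆) ≢ rk (S - s)

    minimal-spanning : ∀ e X → rk (X ∪ ⁅ e ⁆) ≡ rk X →
                       ∃ λ S → S ⊆ X × rk (S ∪ ⁅ e ⁆) ≡ rk S × Minimal e S
    minimal-spanning e X = go ∣ X ∣ X refl
      where
      go : ∀ k X → ∣ X ∣ ≡ k → rk (X ∪ ⁅ e ⁆) ≡ rk X →
           ∃ λ S → S ⊆ X × rk (S ∪ ⁅ e ⁆) ≡ rk S × Minimal e S
      go k X ∣X∣≡k spans with FP.any? (λ s → s SP.∈? X ×-dec (rk ((X - s) ∪ ⁅ e ⁆) NP.≟ rk (X - s)))
      ... | no none = X , (λ m → m) , spans , λ s∈X eq → none (_ , s∈X , eq)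
      ... | yes (s , s∈X , spans-X-s) with k
      ...   | zero   = ⊥-elim (NP.1+n≢0 (trans (card-remove X s∈X) ∣X∣≡k))
      ...   | suc k' with go k' (X - s) (NP.suc-injective (trans (card-remove X s∈X) ∣X∣≡k)) spans-X-s
      ...     | S , S⊆X-s , spans-S , minimal = S , SP.p─q⊆p X ⁅ s ⁆ ∘ S⊆X-s , spans-S , minimal

    module MinimalSpanning {e S} (e∉S : e ∉ S) (spans : rk (S ∪ ⁅ e ⁆) ≡ rk S) (minimal : Minimal e S) where

      jump : ∀ {s} → s ∈ S → rk ((S - s) ∪ ⁅ e ⁆) ≡ suc (rk (S - s))
      jump s∈S = NP.≤-antisym (r-insert _ e) (NP.≤∧≢⇒< (mono (SP.p⊆p∪q ⁅ e ⁆)) (minimal s∈S ∘ sym))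

      independent : Independent S
      independent = independent-if-critical S critical
        where
        critical : Critical S
        critical {s} s∈S = begin-strict
          rk (S - s)            <⟨ NP.≤-reflexive (sym (jump s∈S)) ⟩
          rk ((S - s) ∪ ⁅ e ⁆)  ≤⟨ mono (∪-monoˡ ⁅ e ⁆ (SP.p─q⊆p S ⁅ s ⁆)) ⟩
          rk (S ∪ ⁅ e ⁆)        ≡⟨ spans ⟩
          rk S                  ∎
          where open NP.≤-Reasoning

      independent-swap : ∀ {t} → t ∈ S → Independent ((S - t) ∪ ⁅ e ⁆)
      independent-swap {t} t∈S = begin
        rk ((S - t) ∪ ⁅ e ⁆)  ≡⟨ jump t∈S ⟩
        suc (rk (S - t))      ≡⟨ cong suc (independent-⊆ (SP.p─q⊆p S ⁅ t ⁆) independent) ⟩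
        suc ∣ S - t ∣         ≡⟨ sym (card-insert (S - t) (e∉S ∘ SP.p─q⊆p S ⁅ t ⁆)) ⟩
        ∣ (S - t) ∪ ⁅ e ⁆ ∣   ∎
        where open ≡-Reasoning

      is-circuit : IsCircuit (S ∪ ⁅ e ⁆)
      is-circuit = dependent , proper-independent
        where
        dependent : rk (S ∪ ⁅ e ⁆) < ∣ S ∪ ⁅ e ⁆ ∣
        dependent = subst₂ _<_ (sym (trans spans independent)) (sym (card-insert S e∉S)) (NP.n<1+n _)
        proper-independent : ∀ D → D ⊆ S ∪ ⁅ e ⁆ → ∣ D ∣ < ∣ S ∪ ⁅ e ⁆ ∣ → Independent D
        proper-independent D D⊆C ∣D∣<∣C∣ with smaller-subset-misses D⊆C ∣D∣<∣C∣
        ... | t , t∈C , t∉D with SP.x∈p∪q⁻ S ⁅ e ⁆ t∈C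
        ...   | inj₂ t∈e = independent-⊆ D⊆S independent
          where
          D⊆S : D ⊆ S
          D⊆S x∈D with SP.x∈p∪q⁻ S ⁅ e ⁆ (D⊆C x∈D)
          ... | inj₁ x∈S = x∈S
          ... | inj₂ x∈e = ⊥-elim (t∉D (subst (_∈ D) x≡t x∈D))
            where x≡t = trans (SP.x∈⁅y⁆⇒x≡y e x∈e) (sym (SP.x∈⁅y⁆⇒x≡y e t∈e))
        ...   | inj₁ t∈S = independent-⊆ D⊆ (independent-swap t∈S)
          where
          D⊆ : D ⊆ (S - t) ∪ ⁅ e ⁆
          D⊆ x∈D with SP.x∈p∪q⁻ S ⁅ e ⁆ (D⊆C x∈D)
          ... | inj₁ x∈S = SP.x∈p∪q⁺ (inj₁ (SP.x∈p∧x≢y⇒x∈p-y x∈S λ { refl → t∉D x∈D }))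
          ... | inj₂ x∈e = SP.x∈p∪q⁺ (inj₂ x∈e)

    spans-circuit : ∀ {X e} → e ∉ X → rk (X ∪ ⁅ e ⁆) ≡ rk X →
                    ∃ λ C → IsCircuit C × e ∈ C × C ⊆ X ∪ ⁅ e ⁆
    spans-circuit {X} {e} e∉X spans with minimal-spanning e X spans
    ... | S , S⊆X , spans-S , minimal =
      S ∪ ⁅ e ⁆ , MinimalSpanning.is-circuit (e∉X ∘ S⊆X) spans-S minimal ,
      SP.x∈p∪q⁺ (inj₂ (SP.x∈⁅x⁆ e)) , ∪-monoˡ ⁅ e ⁆ S⊆X

module Activities where

  open import Defs
  open Enumeration
  open Subsets
  open Circuits
  open import Data.Bool using (Bool; true; false; T; _∧_; _∨_; not)
  open import Data.Bool.Properties using (T-∧)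
  open import Data.Nat using (suc; _+_; _∸_; _≤_; _≡ᵇ_)
  import Data.Nat.Properties as NP
  open import Data.Nat.Tactic.RingSolver using (solve-∀)
  open import Data.Fin using (Fin; toℕ)
  import Data.Fin.Properties as FP
  open import Data.Fin.Subset
    using (Subset; ⊤; ⁅_⁆; ∁; _∩_; _∪_; _⊆_; ∣_∣; _∈_; _∉_)
  import Data.Fin.Subset.Properties as SP
  open import Data.Vec using (lookup)
  open import Data.List using (allFin)
  open import Data.Bool.ListAction using (any)
  import Data.List.Membership.Propositional.Properties as LMP
  open import Data.Product using (_×_; _,_)
  open import Data.Sum using (inj₁; inj₂)
  open import Data.Empty using (⊥-elim)
  open import Function using (_∘_)
  open import Function.Bundles using (_⇔_; mk⇔; Equivalence)
  open import Relation.Nullary using (yes; no)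
  open import Relation.Binary.PropositionalEquality
  open Equivalence using (to; from)

  module OverFin {n} = Complete (allFin n) LMP.∈-allFin
  module OverSubsets {n} = Complete (allSubsets n) ∈-allSubsets

  ⊆ᵇ-reflect : ∀ {n} {D C : Subset n} → T (D ⊆ᵇ C) ⇔ D ⊆ C
  ⊆ᵇ-reflect {n} {D} {C} = mk⇔
    (λ h {x} x∈D → T⇒∈ (to implication-reflect (OverFin.all-elim test h x) (∈⇒T x∈D)))
    (λ D⊆C → OverFin.all-intro test λ x → from implication-reflect (∈⇒T ∘ D⊆C ∘ T⇒∈))
    where test = λ e → not (e ∈ᵇ D) ∨ (e ∈ᵇ C)

  smallest-reflect : ∀ {n} {e : Fin n} {C} →
                     T (isSmallestOf e C) ⇔ (e ∈ C × ∀ i → i ∈ C → toℕ e ≤ toℕ i)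
  smallest-reflect {n} {e} {C} = mk⇔
    (λ h → let e∈C , least = to T-∧ h in
           T⇒∈ e∈C , λ i i∈C → NP.≤ᵇ⇒≤ (toℕ e) (toℕ i)
                                  (to implication-reflect (OverFin.all-elim test least i) (∈⇒T i∈C)))
    (λ (e∈C , least) → from T-∧ (∈⇒T e∈C ,
           OverFin.all-intro test λ i → from implication-reflect (NP.≤⇒≤ᵇ ∘ least i ∘ T⇒∈)))
    where test = λ i → not (i ∈ᵇ C) ∨ (toℕ e Data.Nat.≤ᵇ toℕ i)

  circuit-reflect : ∀ {n} (M : Matroid n) {C} → T (isCircuit M C) ⇔ RankFacts.IsCircuit M C
  circuit-reflect {n} M {C} = mk⇔
    (λ h → let dep , proper = to T-∧ h in
           NP.<ᵇ⇒< _ _ dep ,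
           λ D D⊆C ∣D∣<∣C∣ → NP.≡ᵇ⇒≡ _ _ (to implication-reflect (OverSubsets.all-elim test proper D)
                                              (from T-∧ (from (⊆ᵇ-reflect {D = D} {C}) (λ {x} → D⊆C {x}) , NP.<⇒<ᵇ ∣D∣<∣C∣))))
    (λ (dep , proper) → from T-∧ (NP.<⇒<ᵇ dep ,
           OverSubsets.all-intro test λ D → from implication-reflect λ D⊂C →
             let D⊆C , ∣D∣<∣C∣ = to (T-∧ {D ⊆ᵇ C}) D⊂C in
             NP.≡⇒≡ᵇ _ _ (proper D (to (⊆ᵇ-reflect {D = D} {C}) D⊆C) (NP.<ᵇ⇒< _ _ ∣D∣<∣C∣))))
    where test = λ D → not (D ⊂ᵇ C) ∨ (r M D ≡ᵇ ∣ D ∣)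

  smallest-within : ∀ {n} {Y C : Subset n} {e} → e ∉ Y → C ⊆ Y ∪ ⁅ e ⁆ →
                    (∀ i → i ∈ C → toℕ e ≤ toℕ i) → C ⊆ (Y ∩ above e) ∪ ⁅ e ⁆
  smallest-within {Y = Y} {C} {e} e∉Y C⊆ least {x} x∈C with SP.x∈p∪q⁻ Y ⁅ e ⁆ (C⊆ x∈C)
  ... | inj₂ x∈e = SP.x∈p∪q⁺ (inj₂ x∈e)
  ... | inj₁ x∈Y with x FP.≟ e
  ...   | yes refl = ⊥-elim (e∉Y x∈Y)
  ...   | no  x≢e  = SP.x∈p∪q⁺ (inj₁ (SP.x∈p∩q⁺ (x∈Y , ∈-above⁺ e<x)))
    where e<x = NP.≤∧≢⇒< (least x x∈C) (x≢e ∘ sym ∘ FP.toℕ-injective)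

  within-smallest : ∀ {n} {Y C : Subset n} {e} → C ⊆ (Y ∩ above e) ∪ ⁅ e ⁆ →
                    C ⊆ Y ∪ ⁅ e ⁆ × (∀ i → i ∈ C → toℕ e ≤ toℕ i)
  within-smallest {Y = Y} {C} {e} C⊆ = C⊆Y+e , least
    where
    C⊆Y+e : C ⊆ Y ∪ ⁅ e ⁆
    C⊆Y+e x∈C with SP.x∈p∪q⁻ (Y ∩ above e) ⁅ e ⁆ (C⊆ x∈C)
    ... | inj₁ x∈Y∩ = SP.x∈p∪q⁺ (inj₁ (SP.p∩q⊆p Y (above e) x∈Y∩))
    ... | inj₂ x∈e  = SP.x∈p∪q⁺ (inj₂ x∈e)
    least : ∀ i → i ∈ C → toℕ e ≤ toℕ i
    least i i∈C with SP.x∈p∪q⁻ (Y ∩ above e) ⁅ e ⁆ (C⊆ i∈C)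
    ... | inj₁ i∈Y∩ = NP.<⇒≤ (∈-above⁻ (SP.p∩q⊆q Y (above e) i∈Y∩))
    ... | inj₂ i∈e  = NP.≤-reflexive (cong toℕ (sym (SP.x∈⁅y⁆⇒x≡y e i∈e)))

  circuit-test : ∀ {n} (M : Matroid n) (Y : Subset n) e → e ∉ Y →
    any (λ C → isCircuit M C ∧ (C ⊆ᵇ (Y ∪ ⁅ e ⁆)) ∧ isSmallestOf e C) (allSubsets n)
    ≡ (r M (Y ∩ above e ∪ ⁅ e ⁆) ≡ᵇ r M (Y ∩ above e))
  circuit-test {n} M Y e e∉Y = T-ext found⇒spans spans⇒found
    where
    open RankFacts M
    test = λ C → isCircuit M C ∧ (C ⊆ᵇ (Y ∪ ⁅ e ⁆)) ∧ isSmallestOf e C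
    found⇒spans : T (any test (allSubsets n)) → T (r M (Y ∩ above e ∪ ⁅ e ⁆) ≡ᵇ r M (Y ∩ above e))
    found⇒spans h with OverSubsets.any-elim test h
    ... | C , hC with to T-∧ hC
    ...   | circuit , rest with to T-∧ rest
    ...     | C⊆ , smallest with to smallest-reflect smallest
    ...       | e∈C , least =
      NP.≡⇒≡ᵇ _ _ (circuit-spans (to (circuit-reflect M) circuit) e∈C
                    (smallest-within e∉Y (to (⊆ᵇ-reflect {D = C}) C⊆) least))
    spans⇒found : T (r M (Y ∩ above e ∪ ⁅ e ⁆) ≡ᵇ r M (Y ∩ above e)) → T (any test (allSubsets n))
    spans⇒found h with spans-circuit (e∉Y ∘ SP.p∩q⊆p Y (above e)) (NP.≡ᵇ⇒≡ _ _ h)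
    ... | C , circuit , e∈C , C⊆ =
      let C⊆Y+e , least = within-smallest {Y = Y} C⊆ in
      OverSubsets.any-intro test C
        (from T-∧ (from (circuit-reflect M) circuit ,
                   from T-∧ (from (⊆ᵇ-reflect {D = C}) (λ {x} → C⊆Y+e {x}) ,
                             from smallest-reflect (e∈C , least))))

  ∸-+-mono : ∀ R {x y z w} → R ≤ x → R ≤ y → x + y ≤ z + w → (x ∸ R) + (y ∸ R) ≤ (z ∸ R) + (w ∸ R)
  ∸-+-mono R {x} {y} {z} {w} R≤x R≤y le = NP.+-cancelˡ-≤ (R + R) _ _ (begin
    (R + R) + ((x ∸ R) + (y ∸ R))  ≡⟨ shuffle R (x ∸ R) (y ∸ R) ⟩
    (R + (x ∸ R)) + (R + (y ∸ R))  ≡⟨ cong₂ _+_ (NP.m+[n∸m]≡n R≤x) (NP.m+[n∸m]≡n R≤y) ⟩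
    x + y                          ≤⟨ le ⟩
    z + w                          ≤⟨ NP.+-mono-≤ (NP.m≤n+m∸n z R) (NP.m≤n+m∸n w R) ⟩
    (R + (z ∸ R)) + (R + (w ∸ R))  ≡⟨ sym (shuffle R (z ∸ R) (w ∸ R)) ⟩
    (R + R) + ((z ∸ R) + (w ∸ R))  ∎)
    where
    open NP.≤-Reasoning
    shuffle : ∀ a b c → (a + a) + (b + c) ≡ (a + b) + (a + c)
    shuffle = solve-∀

  module DualRank {n} (M : Matroid n) where
    open RankFacts M using (r-subadditive)
    R = rankM M

    -- The subtraction in r* never truncates.
    rank≤ : ∀ Z → R ≤ ∣ Z ∣ + r M (∁ Z)
    rank≤ Z = begin
      r M ⊤                ≡⟨ cong (r M) (sym (SP.p∪∁p≡⊤ Z)) ⟩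
      r M (Z ∪ ∁ Z)        ≤⟨ r-subadditive Z (∁ Z) ⟩
      r M Z + r M (∁ Z)    ≤⟨ NP.+-monoˡ-≤ (r M (∁ Z)) (r-bounded M Z) ⟩
      ∣ Z ∣ + r M (∁ Z)    ∎
      where open NP.≤-Reasoning

    bounded : ∀ A → dualRank M A ≤ ∣ A ∣
    bounded A = begin
      (∣ A ∣ + r M (∁ A)) ∸ R  ≤⟨ NP.∸-monoˡ-≤ R (NP.+-monoʳ-≤ (∣ A ∣) (r-mono M SP.⊆⊤)) ⟩
      (∣ A ∣ + R) ∸ R          ≡⟨ NP.m+n∸n≡m (∣ A ∣) R ⟩
      ∣ A ∣                    ∎
      where open NP.≤-Reasoning

    mono : ∀ {A B} → A ⊆ B → dualRank M A ≤ dualRank M B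
    mono {A} {B} A⊆B = NP.∸-monoˡ-≤ R (begin
      ∣ A ∣ + r M (∁ A)              ≤⟨ NP.+-monoʳ-≤ (∣ A ∣) (NP.≤-trans (r-mono M ∁A⊆) (r-subadditive (∁ B) W)) ⟩
      ∣ A ∣ + (r M (∁ B) + r M W)    ≤⟨ NP.+-monoʳ-≤ (∣ A ∣) (NP.+-monoʳ-≤ (r M (∁ B)) (r-bounded M W)) ⟩
      ∣ A ∣ + (r M (∁ B) + ∣ W ∣)    ≡⟨ shuffle (∣ A ∣) (r M (∁ B)) (∣ W ∣) ⟩
      (∣ A ∣ + ∣ W ∣) + r M (∁ B)    ≡⟨ cong (_+ r M (∁ B)) ∣A∣+∣W∣≡∣B∣ ⟩
      ∣ B ∣ + r M (∁ B)              ∎)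
      where
      open NP.≤-Reasoning
      W = B ∩ ∁ A
      ∣A∣+∣W∣≡∣B∣ : ∣ A ∣ + ∣ W ∣ ≡ ∣ B ∣
      ∣A∣+∣W∣≡∣B∣ = trans (cong (_+ ∣ W ∣) (card-cong (λ m → SP.x∈p∩q⁺ (A⊆B m , m)) (SP.p∩q⊆q B A)))
                          (card-split B A)
      ∁A⊆ : ∁ A ⊆ ∁ B ∪ W
      ∁A⊆ {x} x∈∁A with x SP.∈? B
      ... | yes x∈B = SP.x∈p∪q⁺ (inj₂ (SP.x∈p∩q⁺ (x∈B , x∈∁A)))
      ... | no  x∉B = SP.x∈p∪q⁺ (inj₁ (SP.x∉p⇒x∈∁p x∉B))
      shuffle : ∀ a b c → a + (b + c) ≡ (a + c) + b
      shuffle = solve-∀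

    submod : ∀ A B → dualRank M (A ∪ B) + dualRank M (A ∩ B) ≤ dualRank M A + dualRank M B
    submod A B = ∸-+-mono R (rank≤ (A ∪ B)) (rank≤ (A ∩ B)) (begin
      (∣ A ∪ B ∣ + r M (∁ (A ∪ B))) + (∣ A ∩ B ∣ + r M (∁ (A ∩ B)))
        ≡⟨ shuffle (∣ A ∪ B ∣) _ (∣ A ∩ B ∣) _ ⟩
      (∣ A ∪ B ∣ + ∣ A ∩ B ∣) + (r M (∁ (A ∪ B)) + r M (∁ (A ∩ B)))
        ≡⟨ cong₂ _+_ (card-union A B) (cong₂ _+_ (cong (r M) (∁-∪ A B)) (cong (r M) (∁-∩ A B))) ⟩
      (∣ A ∣ + ∣ B ∣) + (r M (∁ A ∩ ∁ B) + r M (∁ A ∪ ∁ B))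
        ≤⟨ NP.+-monoʳ-≤ (∣ A ∣ + ∣ B ∣) complement-submod ⟩
      (∣ A ∣ + ∣ B ∣) + (r M (∁ A) + r M (∁ B))
        ≡⟨ shuffle (∣ A ∣) (∣ B ∣) _ _ ⟩
      (∣ A ∣ + r M (∁ A)) + (∣ B ∣ + r M (∁ B)) ∎)
      where
      open NP.≤-Reasoning
      shuffle : ∀ a b c d → (a + b) + (c + d) ≡ (a + c) + (b + d)
      shuffle = solve-∀
      complement-submod : r M (∁ A ∩ ∁ B) + r M (∁ A ∪ ∁ B) ≤ r M (∁ A) + r M (∁ B)
      complement-submod = NP.≤-trans (NP.≤-reflexive (NP.+-comm (r M (∁ A ∩ ∁ B)) _)) (r-submod M (∁ A) (∁ B))

    -- For e ∉ X, e is in the dual closure of X iff e is a coloop of E ∖ X.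
    closure-test : ∀ X e → e ∉ X →
      (dualRank M (X ∪ ⁅ e ⁆) ≡ᵇ dualRank M X) ≡ (suc (r M (∁ (X ∪ ⁅ e ⁆))) ≡ᵇ r M (∁ X))
    closure-test X e e∉X = ≡ᵇ-cong to-coloop from-coloop
      where
      a = r M (∁ (X ∪ ⁅ e ⁆))
      b = r M (∁ X)
      sizes : ∣ X ∪ ⁅ e ⁆ ∣ + a ≡ ∣ X ∣ + suc a
      sizes = trans (cong (_+ a) (card-insert X e∉X)) (sym (NP.+-suc (∣ X ∣) a))
      to-coloop : dualRank M (X ∪ ⁅ e ⁆) ≡ dualRank M X → suc a ≡ b
      to-coloop eq = NP.+-cancelˡ-≡ (∣ X ∣) (suc a) b (trans (sym sizes)
        (trans (sym (NP.m∸n+n≡m (rank≤ (X ∪ ⁅ e ⁆)))) (trans (cong (_+ R) eq) (NP.m∸n+n≡m (rank≤ X)))))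
      from-coloop : suc a ≡ b → dualRank M (X ∪ ⁅ e ⁆) ≡ dualRank M X
      from-coloop eq = cong (_∸ R) (trans sizes (cong (∣ X ∣ +_) eq))

  dual : ∀ {n} → Matroid n → Matroid n
  dual M = record
    { r         = dualRank M
    ; r-bounded = DualRank.bounded M
    ; r-mono    = DualRank.mono M
    ; r-submod  = DualRank.submod M
    }

  extActive : ∀ {n} → Matroid n → Subset n → Fin n → Bool
  extActive M A e = not (e ∈ᵇ A) ∧ (r M (A ∩ above e ∪ ⁅ e ⁆) ≡ᵇ r M (A ∩ above e))

  intActive : ∀ {n} → Matroid n → Subset n → Fin n → Bool
  intActive M A e = (e ∈ᵇ A) ∧ (suc (r M (∁ (∁ A ∩ above e ∪ ⁅ e ⁆))) ≡ᵇ r M (∁ (∁ A ∩ above e)))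

  inExt≡extActive : ∀ {n} (M : Matroid n) A e → inExt M A e ≡ extActive M A e
  inExt≡extActive M A e with lookup A e in e∈ᵇA
  ... | true  = refl
  ... | false = circuit-test M A e (λ e∈A → subst T e∈ᵇA (∈⇒T e∈A))

  -- Internal activity is external activity of the complement in the dual matroid.
  inInt≡intActive : ∀ {n} (M : Matroid n) A e → inInt M A e ≡ intActive M A e
  inInt≡intActive M A e with lookup A e in e∈ᵇA
  ... | false = refl
  ... | true  = trans (circuit-test (dual M) (∁ A) e (SP.x∈p⇒x∉∁p e∈A))
                      (DualRank.closure-test M (∁ A ∩ above e) e
                        (SP.x∈p⇒x∉∁p e∈A ∘ SP.p∩q⊆p (∁ A) (above e)))
    where e∈A = T⇒∈ (subst T (sym e∈ᵇA) _)

  ε≡count : ∀ {n} (M : Matroid n) A → ε M A ≡ count n (extActive M A)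
  ε≡count {n} M A = trans (length-filter-allFin n (inExt M A)) (count-cong n (inExt≡extActive M A))

  ι≡count : ∀ {n} (M : Matroid n) A → ι M A ≡ count n (intActive M A)
  ι≡count {n} M A = trans (length-filter-allFin n (inInt M A)) (count-cong n (inInt≡intActive M A))

module Minors where

  open import Defs
  open Enumeration
  open Subsets
  open Circuits
  open Activities
  open import Data.Bool using (Bool; true; false; _∧_; _∨_; not)
  import Data.Bool.Properties as BP
  open import Data.Nat using (ℕ; suc; _+_; _∸_; _≤_; _≡ᵇ_)
  import Data.Nat.Properties as NP
  open import Data.Nat.Tactic.RingSolver using (solve-∀)
  open import Data.Fin using (inject₁; fromℕ)
  open import Data.Fin.Subset
    using (Subset; ⊤; ⁅_⁆; ∁; _∩_; _∪_; _⊆_; ∣_∣; inside; outside)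
    renaming (⊥ to ∅)
  import Data.Fin.Subset.Properties as SP
  open import Data.Vec using (lookup; _∷ʳ_)
  import Data.Vec.Properties as VP
  open import Function using (_∘_; id)
  open import Relation.Nullary using (yes; no)
  open import Relation.Binary.PropositionalEquality

  record Profile : Set where
    constructor ⟨_,_,_,_⟩
    field
      corank nullity internal external : ℕ

  open Profile public

  profile : ∀ {n} → Matroid n → Subset n → Profile
  profile {n} M A = ⟨ cr M A , nl M A , count n (intActive M A) , count n (extActive M A) ⟩

  +corank +nullity +internal +external : Profile → Profile
  +corank   d = record d { corank   = suc (corank d) }
  +nullity  d = record d { nullity  = suc (nullity d) }
  +internal d = record d { internal = suc (internal d) }
  +external d = record d { external = suc (external d) }

  ∩-above-inject₁ : ∀ {n} (A : Subset n) b e → (A ∷ʳ b) ∩ above (inject₁ e) ≡ (A ∩ above e) ∷ʳ b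
  ∩-above-inject₁ A b e = begin
    (A ∷ʳ b) ∩ above (inject₁ e)    ≡⟨ cong ((A ∷ʳ b) ∩_) (above-inject₁ e) ⟩
    (A ∷ʳ b) ∩ (above e ∷ʳ inside)  ≡⟨ ∩-∷ʳ A (above e) b inside ⟩
    (A ∩ above e) ∷ʳ (b ∧ true)     ≡⟨ cong ((A ∩ above e) ∷ʳ_) (BP.∧-identityʳ b) ⟩
    (A ∩ above e) ∷ʳ b              ∎
    where open ≡-Reasoning

  ∪-⁅inject₁⁆ : ∀ {n} (X : Subset n) b e → (X ∷ʳ b) ∪ ⁅ inject₁ e ⁆ ≡ (X ∪ ⁅ e ⁆) ∷ʳ b
  ∪-⁅inject₁⁆ X b e = begin
    (X ∷ʳ b) ∪ ⁅ inject₁ e ⁆        ≡⟨ cong ((X ∷ʳ b) ∪_) (⁅inject₁⁆ e) ⟩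
    (X ∷ʳ b) ∪ (⁅ e ⁆ ∷ʳ outside)   ≡⟨ ∪-∷ʳ X ⁅ e ⁆ b outside ⟩
    (X ∪ ⁅ e ⁆) ∷ʳ (b ∨ false)      ≡⟨ cong ((X ∪ ⁅ e ⁆) ∷ʳ_) (BP.∨-identityʳ b) ⟩
    (X ∪ ⁅ e ⁆) ∷ʳ b                ∎
    where open ≡-Reasoning

  ∸-offset : ∀ j k y z → z ≤ y → (j + (k + y)) ∸ (k + z) ≡ j + (y ∸ z)
  ∸-offset j k y z z≤y = begin
    (j + (k + y)) ∸ (k + z)  ≡⟨ cong (_∸ (k + z)) (swap-front j k y) ⟩
    (k + (j + y)) ∸ (k + z)  ≡⟨ NP.[m+n]∸[m+o]≡n∸o k (j + y) z ⟩
    (j + y) ∸ z              ≡⟨ NP.+-∸-assoc j z≤y ⟩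
    j + (y ∸ z)              ∎
    where
    open ≡-Reasoning
    swap-front : ∀ a b c → a + (b + c) ≡ b + (a + c)
    swap-front = solve-∀

  -- Shifted minors: if r_M(S ∷ʳ b) = k + r_{M'}(S) for all S, then all statistics
  -- of A ∷ʳ b in M are read off from A in M' and from the largest element alone.
  module Shift {n} (M : Matroid (suc n)) (M' : Matroid n) (b : Bool) (k : ℕ)
               (shift : ∀ S → r M (S ∷ʳ b) ≡ k + r M' S) where

    extActive-shift : ∀ A e → extActive M (A ∷ʳ b) (inject₁ e) ≡ extActive M' A e
    extActive-shift A e = begin
      extActive M (A ∷ʳ b) (inject₁ e)
        ≡⟨ cong₂ _∧_ (cong not (lookup-∷ʳ-inject₁ A b e))
                     (cong₂ (λ X Y → r M X ≡ᵇ r M Y) (trans (cong (_∪ ⁅ inject₁ e ⁆) (∩-above-inject₁ A b e))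
                                                             (∪-⁅inject₁⁆ (A ∩ above e) b e))
                                                      (∩-above-inject₁ A b e)) ⟩
      not (lookup A e) ∧ (r M ((A ∩ above e ∪ ⁅ e ⁆) ∷ʳ b) ≡ᵇ r M ((A ∩ above e) ∷ʳ b))
        ≡⟨ cong (not (lookup A e) ∧_) (cong₂ _≡ᵇ_ (shift _) (shift _)) ⟩
      not (lookup A e) ∧ (k + r M' (A ∩ above e ∪ ⁅ e ⁆) ≡ᵇ k + r M' (A ∩ above e))
        ≡⟨ cong (not (lookup A e) ∧_) (≡ᵇ-cong (NP.+-cancelˡ-≡ k _ _) (cong (k +_))) ⟩
      extActive M' A e ∎
      where open ≡-Reasoning

    intActive-shift : ∀ A e → intActive M (A ∷ʳ b) (inject₁ e) ≡ intActive M' A e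
    intActive-shift A e = begin
      intActive M (A ∷ʳ b) (inject₁ e)
        ≡⟨ cong₂ _∧_ (lookup-∷ʳ-inject₁ A b e)
                     (cong₂ (λ X Y → suc (r M X) ≡ᵇ r M Y)
                            (trans (cong (λ Z → ∁ (Z ∪ ⁅ inject₁ e ⁆)) outside-part)
                                   (trans (cong ∁ (∪-⁅inject₁⁆ U (not b) e)) (∁-∁ (U ∪ ⁅ e ⁆))))
                            (trans (cong ∁ outside-part) (∁-∁ U))) ⟩
      lookup A e ∧ (suc (r M (∁ (U ∪ ⁅ e ⁆) ∷ʳ b)) ≡ᵇ r M (∁ U ∷ʳ b))
        ≡⟨ cong (lookup A e ∧_) (cong₂ _≡ᵇ_ (cong suc (shift _)) (shift _)) ⟩
      lookup A e ∧ (suc (k + r M' (∁ (U ∪ ⁅ e ⁆))) ≡ᵇ k + r M' (∁ U))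
        ≡⟨ cong (lookup A e ∧_) (≡ᵇ-cong (NP.+-cancelˡ-≡ k _ _ ∘ trans (NP.+-suc k _))
                                         (trans (sym (NP.+-suc k _)) ∘ cong (k +_))) ⟩
      intActive M' A e ∎
      where
      open ≡-Reasoning
      U = ∁ A ∩ above e
      outside-part : ∁ (A ∷ʳ b) ∩ above (inject₁ e) ≡ U ∷ʳ not b
      outside-part = trans (cong (_∩ above (inject₁ e)) (∁-∷ʳ A b)) (∩-above-inject₁ (∁ A) (not b) e)
      ∁-∁ : ∀ X → ∁ (X ∷ʳ not b) ≡ ∁ X ∷ʳ b
      ∁-∁ X = trans (∁-∷ʳ X (not b)) (cong (∁ X ∷ʳ_) (BP.not-involutive b))

    profile-shift : ∀ {jc jn i x} → rankM M ≡ jc + (k + rankM M') → (∀ A → ∣ A ∷ʳ b ∣ ≡ jn + (k + ∣ A ∣)) →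
                    (∀ A → intActive M (A ∷ʳ b) (fromℕ n) ≡ i) → (∀ A → extActive M (A ∷ʳ b) (fromℕ n) ≡ x) →
                    ∀ A → profile M (A ∷ʳ b) ≡
                          ⟨ jc + cr M' A , jn + nl M' A , ind i + count n (intActive M' A) , ind x + count n (extActive M' A) ⟩
    profile-shift {jc} {jn} {i} {x} rank≡ size≡ int-last ext-last A = cong₄ ⟨_,_,_,_⟩
      (trans (cong₂ _∸_ rank≡ (shift A)) (∸-offset jc k _ _ (r-mono M' SP.⊆⊤)))
      (trans (cong₂ _∸_ (size≡ A) (shift A)) (∸-offset jn k _ _ (r-bounded M' A)))
      (trans (count-last n (intActive M (A ∷ʳ b))) (cong₂ _+_ (cong ind (int-last A)) (count-cong n (intActive-shift A))))
      (trans (count-last n (extActive M (A ∷ʳ b))) (cong₂ _+_ (cong ind (ext-last A)) (count-cong n (extActive-shift A))))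
      where
      cong₄ : ∀ {A B C D E : Set} (f : A → B → C → D → E) {a a' b b' c c' d d'} →
              a ≡ a' → b ≡ b' → c ≡ c' → d ≡ d' → f a b c d ≡ f a' b' c' d'
      cong₄ f refl refl refl refl = refl

  module LastElement {n} (M : Matroid (suc n)) where
    open RankFacts M using (r-cong; r-subadditive; r-empty)

    rℓ : ℕ
    rℓ = r M (∅ ∷ʳ inside)

    rℓ≤1 : rℓ ≤ 1
    rℓ≤1 = subst (rℓ ≤_) (trans (card-∷ʳ-inside (∅ {n})) (cong suc (SP.∣⊥∣≡0 n))) (r-bounded M _)

    rℓ≤ : ∀ S → rℓ ≤ r M (S ∷ʳ inside)
    rℓ≤ S = r-mono M (∷ʳ-⊆ id (SP.⊆-min S))

    deleted≤ : ∀ S → r M (S ∷ʳ outside) ≤ r M (S ∷ʳ inside)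
    deleted≤ S = r-mono M (∷ʳ-⊆ (λ ()) SP.⊆-refl)

    added≤ : ∀ S → r M (S ∷ʳ inside) ≤ r M (S ∷ʳ outside) + rℓ
    added≤ S = NP.≤-trans (r-mono M ⊆-split) (r-subadditive (S ∷ʳ outside) (∅ ∷ʳ inside))
      where
      ⊆-split : (S ∷ʳ inside) ⊆ (S ∷ʳ outside) ∪ (∅ ∷ʳ inside)
      ⊆-split = subst ((S ∷ʳ inside) ⊆_) (sym (∪-∷ʳ S ∅ outside inside)) (∷ʳ-⊆ id (SP.p⊆p∪q ∅))

    rank-∷ʳ : rankM M ≡ r M (⊤ ∷ʳ inside)
    rank-∷ʳ = cong (r M) (⊤-∷ʳ n)

    deletion : Matroid n
    deletion = record
      { r         = λ S → r M (S ∷ʳ outside)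
      ; r-bounded = λ A → subst (r M (A ∷ʳ outside) ≤_) (card-∷ʳ-outside A) (r-bounded M _)
      ; r-mono    = λ A⊆B → r-mono M (∷ʳ-⊆ id A⊆B)
      ; r-submod  = λ A B → subst₂ (λ U I → r M U + r M I ≤ r M (A ∷ʳ outside) + r M (B ∷ʳ outside))
                                   (∪-∷ʳ A B outside outside) (∩-∷ʳ A B outside outside)
                                   (r-submod M (A ∷ʳ outside) (B ∷ʳ outside))
      }

    contraction : Matroid n
    contraction = record
      { r         = λ S → r M (S ∷ʳ inside) ∸ rℓ
      ; r-bounded = λ A → NP.≤-trans (NP.∸-monoˡ-≤ rℓ (added≤ A))
                            (NP.≤-trans (NP.≤-reflexive (NP.m+n∸n≡m _ rℓ)) (r-bounded deletion A))
      ; r-mono    = λ A⊆B → NP.∸-monoˡ-≤ rℓ (r-mono M (∷ʳ-⊆ id A⊆B))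
      ; r-submod  = λ A B → ∸-+-mono rℓ (rℓ≤ (A ∪ B)) (rℓ≤ (A ∩ B))
          (subst₂ (λ U I → r M U + r M I ≤ r M (A ∷ʳ inside) + r M (B ∷ʳ inside))
                  (∪-∷ʳ A B inside inside) (∩-∷ʳ A B inside inside)
                  (r-submod M (A ∷ʳ inside) (B ∷ʳ inside)))
      }

    -- Activities of the largest element e: it can only be externally active when it is
    -- a loop and internally active when it is a coloop.
    ext-last : ∀ A b → extActive M (A ∷ʳ b) (fromℕ n) ≡ not b ∧ (rℓ ≡ᵇ 0)
    ext-last A b = cong₂ _∧_ (cong not (lookup-∷ʳ-last A b))
                             (cong₂ _≡ᵇ_ (cong (r M) (trans (cong (_∪ ⁅ fromℕ n ⁆) none-above)
                                                            (trans (SP.∪-identityˡ _) (⁅last⁆ n))))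
                                         (trans (cong (r M) none-above) (r-empty SP.⊆-refl)))
      where
      none-above : (A ∷ʳ b) ∩ above (fromℕ n) ≡ ∅
      none-above = trans (cong ((A ∷ʳ b) ∩_) (above-last n)) (SP.∩-zeroʳ _)

    int-last : ∀ A b → intActive M (A ∷ʳ b) (fromℕ n) ≡ b ∧ (suc (r M (⊤ ∷ʳ outside)) ≡ᵇ r M (⊤ ∷ʳ inside))
    int-last A b = cong₂ _∧_ (lookup-∷ʳ-last A b)
                             (cong₂ (λ X Y → suc (r M X) ≡ᵇ r M Y)
                                    (trans (cong (λ Z → ∁ (Z ∪ ⁅ fromℕ n ⁆)) none-above)
                                      (trans (cong ∁ (trans (SP.∪-identityˡ _) (⁅last⁆ n)))
                                        (trans (∁-∷ʳ ∅ inside) (cong (_∷ʳ outside) ∁∅))))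
                                    (trans (cong ∁ none-above) (trans ∁∅ (⊤-∷ʳ n))))
      where
      none-above : ∁ (A ∷ʳ b) ∩ above (fromℕ n) ≡ ∅
      none-above = trans (cong (∁ (A ∷ʳ b) ∩_) (above-last n)) (SP.∩-zeroʳ _)
      ∁∅ : ∀ {m} → ∁ (∅ {m}) ≡ ⊤
      ∁∅ {m} = VP.map-replicate not outside m

    module Deleted = Shift M deletion outside 0 (λ S → refl)

  data LastElementKind {n} (M : Matroid (suc n)) : Set where
    loop     : (D : Matroid n) → (∀ A → profile M (A ∷ʳ outside) ≡ +external (profile D A))
                               → (∀ A → profile M (A ∷ʳ inside)  ≡ +nullity  (profile D A)) → LastElementKind M
    coloop   : (D : Matroid n) → (∀ A → profile M (A ∷ʳ outside) ≡ +corank   (profile D A))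
                               → (∀ A → profile M (A ∷ʳ inside)  ≡ +internal (profile D A)) → LastElementKind M
    ordinary : (D C : Matroid n) → (∀ A → profile M (A ∷ʳ outside) ≡ profile D A)
                                 → (∀ A → profile M (A ∷ʳ inside)  ≡ profile C A) → LastElementKind M

  module _ {n} (M : Matroid (suc n)) where
    open LastElement M

    -- e is a loop: it never raises the rank, and it is externally active exactly when absent.
    loop-kind : rℓ ≡ 0 → LastElementKind M
    loop-kind rℓ≡0 = loop deletion
      (Deleted.profile-shift {jc = 0} {jn = 0} {i = false} {x = true}  rank≡ card-∷ʳ-outside (not-coloop outside) (ext≡ outside))
      (Added.profile-shift   {jc = 0} {jn = 1} {i = false} {x = false} rank≡ card-∷ʳ-inside  (not-coloop inside)  (ext≡ inside))
      where
      added : ∀ S → r M (S ∷ʳ inside) ≡ 0 + r deletion S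
      added S = NP.≤-antisym (subst (r M (S ∷ʳ inside) ≤_) no-increase (added≤ S)) (deleted≤ S)
        where
        no-increase : r M (S ∷ʳ outside) + rℓ ≡ r M (S ∷ʳ outside)
        no-increase = trans (cong (r M (S ∷ʳ outside) +_) rℓ≡0) (NP.+-identityʳ _)
      module Added = Shift M deletion inside 0 added
      rank≡ : rankM M ≡ 0 + (0 + rankM deletion)
      rank≡ = trans rank-∷ʳ (added ⊤)
      not-coloop : ∀ b A → intActive M (A ∷ʳ b) (fromℕ n) ≡ false
      not-coloop b A = trans (int-last A b) (trans (cong (b ∧_) (≢⇒≡ᵇ-false (λ eq → NP.1+n≢n (trans eq (added ⊤)))))
                                                   (BP.∧-zeroʳ b))
      ext≡ : ∀ b A → extActive M (A ∷ʳ b) (fromℕ n) ≡ not b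
      ext≡ b A = trans (ext-last A b) (trans (cong (λ z → not b ∧ (z ≡ᵇ 0)) rℓ≡0) (BP.∧-identityʳ (not b)))

    -- e is a coloop: it always raises the rank, and it is internally active exactly when present.
    coloop-kind : rℓ ≢ 0 → suc (r M (⊤ ∷ʳ outside)) ≡ r M (⊤ ∷ʳ inside) → LastElementKind M
    coloop-kind rℓ≢0 is-coloop = coloop deletion
      (Deleted.profile-shift {jc = 1} {jn = 0} {i = false} {x = false} (trans rank-∷ʳ (sym is-coloop))
                             card-∷ʳ-outside (int≡ outside) (not-loop outside))
      (Added.profile-shift   {jc = 0} {jn = 0} {i = true}  {x = false} (trans rank-∷ʳ (sym is-coloop))
                             card-∷ʳ-inside  (int≡ inside)  (not-loop inside))
      where
      -- Submodularity with E ∖ e forces e to raise the rank of every set.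
      added : ∀ S → r M (S ∷ʳ inside) ≡ 1 + r deletion S
      added S = NP.≤-antisym (NP.≤-trans (added≤ S) (NP.≤-trans (NP.+-monoʳ-≤ _ rℓ≤1) (NP.≤-reflexive (NP.+-comm _ 1))))
                             (NP.+-cancelˡ-≤ (r M (⊤ ∷ʳ outside)) _ _ submodular)
        where
        submodular : r M (⊤ ∷ʳ outside) + suc (r deletion S) ≤ r M (⊤ ∷ʳ outside) + r M (S ∷ʳ inside)
        submodular = begin
          r M (⊤ ∷ʳ outside) + suc (r deletion S)
            ≡⟨ trans (NP.+-suc _ _) (cong (_+ r M (S ∷ʳ outside)) is-coloop) ⟩
          r M (⊤ ∷ʳ inside) + r M (S ∷ʳ outside)
            ≡˘⟨ cong₂ _+_ (cong (r M) union) (cong (r M) intersection) ⟩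
          r M ((S ∷ʳ inside) ∪ (⊤ ∷ʳ outside)) + r M ((S ∷ʳ inside) ∩ (⊤ ∷ʳ outside))
            ≤⟨ r-submod M _ _ ⟩
          r M (S ∷ʳ inside) + r M (⊤ ∷ʳ outside)
            ≡⟨ NP.+-comm (r M (S ∷ʳ inside)) _ ⟩
          r M (⊤ ∷ʳ outside) + r M (S ∷ʳ inside) ∎
          where
          open NP.≤-Reasoning
          union : (S ∷ʳ inside) ∪ (⊤ ∷ʳ outside) ≡ ⊤ ∷ʳ inside
          union = trans (∪-∷ʳ S ⊤ inside outside) (cong (_∷ʳ inside) (SP.∪-zeroʳ S))
          intersection : (S ∷ʳ inside) ∩ (⊤ ∷ʳ outside) ≡ S ∷ʳ outside
          intersection = trans (∩-∷ʳ S ⊤ inside outside) (cong (_∷ʳ outside) (SP.∩-identityʳ S))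
      module Added = Shift M deletion inside 1 added
      int≡ : ∀ b A → intActive M (A ∷ʳ b) (fromℕ n) ≡ b
      int≡ b A = trans (int-last A b) (trans (cong (b ∧_) (≡⇒≡ᵇ-true is-coloop)) (BP.∧-identityʳ b))
      not-loop : ∀ b A → extActive M (A ∷ʳ b) (fromℕ n) ≡ false
      not-loop b A = trans (ext-last A b) (trans (cong (not b ∧_) (≢⇒≡ᵇ-false rℓ≢0)) (BP.∧-zeroʳ (not b)))

    -- e is neither: M splits into the deletion and the contraction, and e is never active.
    ordinary-kind : rℓ ≢ 0 → suc (r M (⊤ ∷ʳ outside)) ≢ r M (⊤ ∷ʳ inside) → LastElementKind M
    ordinary-kind rℓ≢0 not-coloop = ordinary deletion contraction
      (Deleted.profile-shift    {jc = 0} {jn = 0} {i = false} {x = false} (trans rank-∷ʳ (sym same-rank))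
                                card-∷ʳ-outside (int≡ outside) (not-loop outside))
      (Contracted.profile-shift {jc = 0} {jn = 0} {i = false} {x = false} (trans rank-∷ʳ (added ⊤))
                                card-∷ʳ-inside  (int≡ inside)  (not-loop inside))
      where
      rℓ≡1 : rℓ ≡ 1
      rℓ≡1 = NP.≤-antisym rℓ≤1 (NP.n≢0⇒n>0 rℓ≢0)
      added : ∀ S → r M (S ∷ʳ inside) ≡ 1 + r contraction S
      added S = sym (trans (cong (_+ (r M (S ∷ʳ inside) ∸ rℓ)) (sym rℓ≡1)) (NP.m+[n∸m]≡n (rℓ≤ S)))
      module Contracted = Shift M contraction inside 1 added
      same-rank : r M (⊤ ∷ʳ outside) ≡ r M (⊤ ∷ʳ inside)
      same-rank = NP.≤-antisym (deleted≤ ⊤) (NP.≤-pred (NP.≤∧≢⇒< at-most-one-more (not-coloop ∘ sym)))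
        where
        at-most-one-more : r M (⊤ ∷ʳ inside) ≤ suc (r M (⊤ ∷ʳ outside))
        at-most-one-more = NP.≤-trans (added≤ ⊤) (NP.≤-reflexive (trans (cong (r M (⊤ ∷ʳ outside) +_) rℓ≡1) (NP.+-comm _ 1)))
      int≡ : ∀ b A → intActive M (A ∷ʳ b) (fromℕ n) ≡ false
      int≡ b A = trans (int-last A b) (trans (cong (b ∧_) (≢⇒≡ᵇ-false not-coloop)) (BP.∧-zeroʳ b))
      not-loop : ∀ b A → extActive M (A ∷ʳ b) (fromℕ n) ≡ false
      not-loop b A = trans (ext-last A b) (trans (cong (not b ∧_) (≢⇒≡ᵇ-false rℓ≢0)) (BP.∧-zeroʳ (not b)))

    classify : LastElementKind M
    classify with rℓ NP.≟ 0 | suc (r M (⊤ ∷ʳ outside)) NP.≟ r M (⊤ ∷ʳ inside)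
    ... | yes rℓ≡0 | _              = loop-kind rℓ≡0
    ... | no  rℓ≢0 | yes is-coloop  = coloop-kind rℓ≢0 is-coloop
    ... | no  rℓ≢0 | no  not-coloop = ordinary-kind rℓ≢0 not-coloop

module Sums where

  open import Data.Bool using (Bool; true; false; if_then_else_)
  open import Data.Integer using (ℤ; +_; _+_; _*_)
  import Data.Integer.Properties as ZP
  open import Data.Integer.Tactic.RingSolver using (solve-∀)
  open import Data.List using (List; []; _∷_; _++_; map; concatMap; filterᵇ)
  open import Data.List.Relation.Unary.All using (All; []; _∷_)
  open import Function using (_∘_)
  open import Relation.Binary.PropositionalEquality

  sumL : ∀ {X : Set} → List X → (X → ℤ) → ℤ
  sumL []       g = + 0
  sumL (x ∷ xs) g = g x + sumL xs g

  module _ {X : Set} where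

    sumL-congᴬ : ∀ {xs : List X} {g h : X → ℤ} → All (λ x → g x ≡ h x) xs → sumL xs g ≡ sumL xs h
    sumL-congᴬ []         = refl
    sumL-congᴬ (eq ∷ eqs) = cong₂ _+_ eq (sumL-congᴬ eqs)

    sumL-cong : ∀ (xs : List X) {g h : X → ℤ} → (∀ x → g x ≡ h x) → sumL xs g ≡ sumL xs h
    sumL-cong []       eq = refl
    sumL-cong (x ∷ xs) eq = cong₂ _+_ (eq x) (sumL-cong xs eq)

    sumL-+ : ∀ (xs : List X) (g h : X → ℤ) → sumL xs (λ x → g x + h x) ≡ sumL xs g + sumL xs h
    sumL-+ []       g h = refl
    sumL-+ (x ∷ xs) g h = trans (cong (_+_ (g x + h x)) (sumL-+ xs g h)) (shuffle (g x) (h x) (sumL xs g) (sumL xs h))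
      where
      shuffle : ∀ a b c d → a + b + (c + d) ≡ a + c + (b + d)
      shuffle = solve-∀

    sumL-scale : ∀ (xs : List X) c (g : X → ℤ) → sumL xs (λ x → c * g x) ≡ c * sumL xs g
    sumL-scale []       c g = sym (ZP.*-zeroʳ c)
    sumL-scale (x ∷ xs) c g = trans (cong (_+_ (c * g x)) (sumL-scale xs c g)) (sym (ZP.*-distribˡ-+ c (g x) (sumL xs g)))

    sumL-scaleʳ : ∀ (xs : List X) c (g : X → ℤ) → sumL xs (λ x → g x * c) ≡ sumL xs g * c
    sumL-scaleʳ xs c g = begin
      sumL xs (λ x → g x * c)  ≡⟨ sumL-cong xs (λ x → ZP.*-comm (g x) c) ⟩
      sumL xs (λ x → c * g x)  ≡⟨ sumL-scale xs c g ⟩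
      c * sumL xs g            ≡⟨ ZP.*-comm c (sumL xs g) ⟩
      sumL xs g * c            ∎
      where open ≡-Reasoning

    sumL-++ : ∀ (xs ys : List X) g → sumL (xs ++ ys) g ≡ sumL xs g + sumL ys g
    sumL-++ []       ys g = sym (ZP.+-identityˡ _)
    sumL-++ (x ∷ xs) ys g = trans (cong (_+_ (g x)) (sumL-++ xs ys g)) (sym (ZP.+-assoc (g x) (sumL xs g) (sumL ys g)))

    sumL-filter : ∀ (P : X → Bool) xs (g : X → ℤ) → sumL (filterᵇ P xs) g ≡ sumL xs (λ x → if P x then g x else + 0)
    sumL-filter P []       g = refl
    sumL-filter P (x ∷ xs) g with P x
    ... | true  = cong (_+_ (g x)) (sumL-filter P xs g)
    ... | false = trans (sumL-filter P xs g) (sym (ZP.+-identityˡ _))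

  sumL-map : ∀ {X Y : Set} (f : X → Y) xs g → sumL (map f xs) g ≡ sumL xs (g ∘ f)
  sumL-map f []       g = refl
  sumL-map f (x ∷ xs) g = cong (_+_ (g (f x))) (sumL-map f xs g)

  sumL-concatMap : ∀ {X Y : Set} (f : X → List Y) xs g → sumL (concatMap f xs) g ≡ sumL xs (λ x → sumL (f x) g)
  sumL-concatMap f []       g = refl
  sumL-concatMap f (x ∷ xs) g = trans (sumL-++ (f x) _ g) (cong (_+_ (sumL (f x) g)) (sumL-concatMap f xs g))

module FallingFactorial where

  open import Data.Bool using (true; false; T)
  open import Data.Nat using (ℕ; zero; suc; _+_; _*_; _∸_; _<_; _≤ᵇ_; _≤?_; s≤s)
  import Data.Nat.Properties as NP
  open import Data.Nat.Tactic.RingSolver using (solve-∀)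
  open import Data.Nat.Combinatorics.Base using (_P′_) renaming (_P_ to _falling_)
  open import Relation.Nullary using (yes; no)
  open import Relation.Binary.PropositionalEquality

  fallingRec : ℕ → ℕ → ℕ
  fallingRec m       zero    = 1
  fallingRec zero    (suc k) = 0
  fallingRec (suc m) (suc k) = suc m * fallingRec m k

  fallingRec-suc : ∀ m k → fallingRec m (suc k) ≡ (m ∸ k) * fallingRec m k
  fallingRec-suc zero    k       = cong (_* fallingRec 0 k) (sym (NP.0∸n≡0 k))
  fallingRec-suc (suc m) zero    = refl
  fallingRec-suc (suc m) (suc k) =
    trans (cong (suc m *_) (fallingRec-suc m k)) (swap-front (suc m) (m ∸ k) (fallingRec m k))
    where
    swap-front : ∀ a b c → a * (b * c) ≡ b * (a * c)
    swap-front = solve-∀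

  fallingRec-vanishes : ∀ m k → m < k → fallingRec m k ≡ 0
  fallingRec-vanishes zero    (suc k) _         = refl
  fallingRec-vanishes (suc m) (suc k) (s≤s m<k) =
    trans (cong (suc m *_) (fallingRec-vanishes m k m<k)) (NP.*-zeroʳ (suc m))

  falling≡fallingRec : ∀ m k → m falling k ≡ fallingRec m k
  falling≡fallingRec m k with k ≤ᵇ m in k≤ᵇm
  ... | true  = P′≡fallingRec k
    where
    P′≡fallingRec : ∀ k → m P′ k ≡ fallingRec m k
    P′≡fallingRec zero    = refl
    P′≡fallingRec (suc k) = trans (cong ((m ∸ k) *_) (P′≡fallingRec k)) (sym (fallingRec-suc m k))
  ... | false = sym (fallingRec-vanishes m k (NP.≰⇒> λ k≤m → subst T k≤ᵇm (NP.≤⇒≤ᵇ k≤m)))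

  fallingRec-pascal : ∀ m k → fallingRec (suc m) (suc k) ≡ fallingRec m (suc k) + suc k * fallingRec m k
  fallingRec-pascal m k with k ≤? m
  ... | yes k≤m = begin
    suc m * fallingRec m k                          ≡⟨ cong (_* fallingRec m k) (sym m∸k+1+k) ⟩
    ((m ∸ k) + suc k) * fallingRec m k              ≡⟨ NP.*-distribʳ-+ (fallingRec m k) (m ∸ k) (suc k) ⟩
    (m ∸ k) * fallingRec m k + suc k * fallingRec m k  ≡⟨ cong (_+ suc k * fallingRec m k) (sym (fallingRec-suc m k)) ⟩
    fallingRec m (suc k) + suc k * fallingRec m k      ∎
    where
    open ≡-Reasoning
    m∸k+1+k : (m ∸ k) + suc k ≡ suc m
    m∸k+1+k = trans (NP.+-suc (m ∸ k) k) (cong suc (NP.m∸n+n≡m k≤m))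
  ... | no  k≰m = begin
    suc m * fallingRec m k                          ≡⟨ cong (suc m *_) (fallingRec-vanishes m k m<k) ⟩
    suc m * 0                                    ≡⟨ NP.*-zeroʳ (suc m) ⟩
    0                                            ≡⟨ sym (NP.*-zeroʳ (suc k)) ⟩
    0 + suc k * 0                                ≡⟨ sym (cong₂ (λ a b → a + suc k * b)
                                                               (fallingRec-vanishes m (suc k) (NP.m<n⇒m<1+n m<k))
                                                               (fallingRec-vanishes m k m<k)) ⟩
    fallingRec m (suc k) + suc k * fallingRec m k      ∎
    where
    open ≡-Reasoning
    m<k = NP.≰⇒> k≰m

  falling-pascal : ∀ m k → (suc m) falling (suc k) ≡ m falling (suc k) + suc k * (m falling k)
  falling-pascal m k
    rewrite falling≡fallingRec (suc m) (suc k) | falling≡fallingRec m (suc k) | falling≡fallingRec m k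
    = fallingRec-pascal m k

  falling-vanishes : ∀ m k → m < k → m falling k ≡ 0
  falling-vanishes m k m<k = trans (falling≡fallingRec m k) (fallingRec-vanishes m k m<k)

module Coefficients where

  open import Defs
  open Enumeration using (ind; ≡⇒≡ᵇ-true)
  open Sums
  open FallingFactorial using (falling-pascal; falling-vanishes)
  open import Data.Bool using (Bool; true; false; _∧_; if_then_else_; T)
  open import Data.Unit using (tt)
  open import Data.Empty using (⊥-elim)
  open import Data.Nat as ℕ using (ℕ; zero; suc; _∸_; _≡ᵇ_)
  import Data.Nat.Properties as NP
  open import Data.Nat.Combinatorics.Base using () renaming (_P_ to _falling_)
  open import Data.Integer using (ℤ; +_; -[1+_]; _+_; _*_; _-_)
  import Data.Integer.Properties as ZP
  open import Data.Integer.Tactic.RingSolver using (solve-∀)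
  open import Data.List using ([]; _∷_; _++_; map; [_])
  import Data.List.Properties as LP
  open import Data.List.Relation.Unary.All as All using (All; []; _∷_)
  import Data.List.Relation.Unary.All.Properties as AllP
  open import Data.Product using (_×_; _,_)
  open import Function using (_∘_)
  open import Relation.Nullary using (yes; no)
  open import Relation.Binary.PropositionalEquality hiding ([_])

  ⟦_⟧ : Bool → ℤ
  ⟦ b ⟧ = + ind b

  ⟦∧⟧-if : ∀ u v x → (if u ∧ v then x else + 0) ≡ ⟦ u ⟧ * ⟦ v ⟧ * x
  ⟦∧⟧-if true  true  x = sym (ZP.*-identityˡ x)
  ⟦∧⟧-if true  false x = sym (ZP.*-zeroˡ x)
  ⟦∧⟧-if false v     x = sym (ZP.*-zeroˡ x)

  -- f(s - 1), or 0 at s = 0: the coefficient sequence of z · f.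
  prev : (ℕ → ℤ) → ℕ → ℤ
  prev f zero    = + 0
  prev f (suc s) = f s

  Term : Set
  Term = ℤ × ℕ × ℕ

  termCoeff : Term → ℕ → ℕ → ℤ
  termCoeff (c , a , b) i j = ⟦ a ≡ᵇ i ⟧ * ⟦ b ≡ᵇ j ⟧ * c

  coeff-sum : ∀ P i j → coeff P i j ≡ sumL P (λ t → termCoeff t i j)
  coeff-sum []                i j = refl
  coeff-sum ((c , a , b) ∷ P) i j = cong₂ _+_ (⟦∧⟧-if (a ≡ᵇ i) (b ≡ᵇ j) c) (coeff-sum P i j)

  coeff-sumₚ : ∀ {X : Set} (f : X → Poly) xs i j → coeff (sumₚ (map f xs)) i j ≡ sumL xs (λ x → coeff (f x) i j)
  coeff-sumₚ f xs i j = trans (coeff-sum (sumₚ (map f xs)) i j) (go xs)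
    where
    go : ∀ xs → sumL (sumₚ (map f xs)) (λ t → termCoeff t i j) ≡ sumL xs (λ x → coeff (f x) i j)
    go []       = refl
    go (x ∷ xs) = trans (sumL-++ (f x) _ _) (cong₂ _+_ (sym (coeff-sum (f x) i j)) (go xs))

  ∂-sumₚ : ∀ {X : Set} p q (f : X → Poly) xs → ∂ p q (sumₚ (map f xs)) ≡ sumₚ (map (∂ p q ∘ f) xs)
  ∂-sumₚ p q f []       = refl
  ∂-sumₚ p q f (x ∷ xs) = trans (LP.map-++ _ (f x) _) (cong (∂ p q (f x) ++_) (∂-sumₚ p q f xs))

  coeff-scaleₚ : ∀ c P i j → coeff (scaleₚ c P) i j ≡ c * coeff P i j
  coeff-scaleₚ c []                i j = sym (ZP.*-zeroʳ c)
  coeff-scaleₚ c ((d , a , b) ∷ P) i j = begin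
    (if (a ≡ᵇ i) ∧ (b ≡ᵇ j) then c * d else + 0) + coeff (scaleₚ c P) i j
      ≡⟨ cong₂ _+_ (⟦∧⟧-if (a ≡ᵇ i) (b ≡ᵇ j) (c * d)) (coeff-scaleₚ c P i j) ⟩
    ⟦ a ≡ᵇ i ⟧ * ⟦ b ≡ᵇ j ⟧ * (c * d) + c * coeff P i j
      ≡⟨ factor ⟦ a ≡ᵇ i ⟧ ⟦ b ≡ᵇ j ⟧ c d (coeff P i j) ⟩
    c * (⟦ a ≡ᵇ i ⟧ * ⟦ b ≡ᵇ j ⟧ * d + coeff P i j)
      ≡⟨ cong (λ z → c * (z + coeff P i j)) (sym (⟦∧⟧-if (a ≡ᵇ i) (b ≡ᵇ j) d)) ⟩
    c * coeff ((d , a , b) ∷ P) i j ∎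
    where
    open ≡-Reasoning
    factor : ∀ u v c d x → u * v * (c * d) + c * x ≡ c * (u * v * d + x)
    factor = solve-∀

  coeff-++ : ∀ P Q i j → coeff (P ++ Q) i j ≡ coeff P i j + coeff Q i j
  coeff-++ P Q i j = begin
    coeff (P ++ Q) i j                              ≡⟨ coeff-sum (P ++ Q) i j ⟩
    sumL (P ++ Q) (λ t → termCoeff t i j)           ≡⟨ sumL-++ P Q _ ⟩
    sumL P (λ t → termCoeff t i j) + sumL Q (λ t → termCoeff t i j)
                                                    ≡⟨ sym (cong₂ _+_ (coeff-sum P i j) (coeff-sum Q i j)) ⟩
    coeff P i j + coeff Q i j                       ∎
    where open ≡-Reasoning

  _·ₜ_ : Term → Term → Term
  (c , a , b) ·ₜ (d , a′ , b′) = (c * d , a ℕ.+ a′ , b ℕ.+ b′)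

  coeff-⊗ : ∀ P Q i j → coeff (P ⊗ Q) i j ≡ sumL P (λ t → sumL Q (λ t′ → termCoeff (t ·ₜ t′) i j))
  coeff-⊗ P Q i j = begin
    coeff (P ⊗ Q) i j                                              ≡⟨ coeff-sum (P ⊗ Q) i j ⟩
    sumL (P ⊗ Q) (λ t → termCoeff t i j)                           ≡⟨ sumL-concatMap (λ t → map (t ·ₜ_) Q) P _ ⟩
    sumL P (λ t → sumL (map (t ·ₜ_) Q) (λ t → termCoeff t i j))   ≡⟨ sumL-cong P (λ t → sumL-map (t ·ₜ_) Q _) ⟩
    sumL P (λ t → sumL Q (λ t′ → termCoeff (t ·ₜ t′) i j))        ∎
    where open ≡-Reasoning

  isX isY : Term → Set
  isX (c , a , b) = b ≡ 0
  isY (c , a , b) = a ≡ 0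

  XOnly YOnly : Poly → Set
  XOnly = All isX
  YOnly = All isY

  XOnly-⊗ : ∀ {P Q} → XOnly P → XOnly Q → XOnly (P ⊗ Q)
  XOnly-⊗ xP xQ = AllP.concat⁺ (AllP.map⁺ (All.map (λ {t} x-t → AllP.map⁺ (All.map (λ {t′} → product t t′ x-t) xQ)) xP))
    where
    product : ∀ t t′ → isX t → isX t′ → isX (t ·ₜ t′)
    product (c , a , b) (d , a′ , b′) = cong₂ ℕ._+_

  YOnly-⊗ : ∀ {P Q} → YOnly P → YOnly Q → YOnly (P ⊗ Q)
  YOnly-⊗ yP yQ = AllP.concat⁺ (AllP.map⁺ (All.map (λ {t} y-t → AllP.map⁺ (All.map (λ {t′} → product t t′ y-t) yQ)) yP))
    where
    product : ∀ t t′ → isY t → isY t′ → isY (t ·ₜ t′)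
    product (c , a , b) (d , a′ , b′) = cong₂ ℕ._+_

  coeff-separated : ∀ {P Q} → XOnly P → YOnly Q → ∀ s u → coeff (P ⊗ Q) s u ≡ coeff P s 0 * coeff Q 0 u
  coeff-separated {P} {Q} xP yQ s u = begin
    coeff (P ⊗ Q) s u
      ≡⟨ coeff-⊗ P Q s u ⟩
    sumL P (λ t → sumL Q (λ t′ → termCoeff (t ·ₜ t′) s u))
      ≡⟨ sumL-congᴬ (All.map (λ {t} → inner t) xP) ⟩
    sumL P (λ t → sumL Q (λ t′ → termCoeff t s 0 * termCoeff t′ 0 u))
      ≡⟨ sumL-cong P (λ t → sumL-scale Q (termCoeff t s 0) (λ t′ → termCoeff t′ 0 u)) ⟩
    sumL P (λ t → termCoeff t s 0 * sumL Q (λ t′ → termCoeff t′ 0 u))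
      ≡⟨ sumL-scaleʳ P _ _ ⟩
    sumL P (λ t → termCoeff t s 0) * sumL Q (λ t′ → termCoeff t′ 0 u)
      ≡⟨ sym (cong₂ _*_ (coeff-sum P s 0) (coeff-sum Q 0 u)) ⟩
    coeff P s 0 * coeff Q 0 u ∎
    where
    open ≡-Reasoning
    factor : ∀ t t′ → isX t → isY t′ → termCoeff (t ·ₜ t′) s u ≡ termCoeff t s 0 * termCoeff t′ 0 u
    factor (c , a , .0) (d , .0 , b′) refl refl rewrite NP.+-identityʳ a = reorder ⟦ a ≡ᵇ s ⟧ ⟦ b′ ≡ᵇ u ⟧ c d
      where
      reorder : ∀ x y c d → x * y * (c * d) ≡ x * + 1 * c * (+ 1 * y * d)
      reorder = solve-∀
    inner : ∀ t → isX t → sumL Q (λ t′ → termCoeff (t ·ₜ t′) s u) ≡ sumL Q (λ t′ → termCoeff t s 0 * termCoeff t′ 0 u)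
    inner t x-t = sumL-congᴬ (All.map (λ {t′} → factor t t′ x-t) yQ)

  coeff-cons-⊗ : ∀ t P Q s u → coeff ((t ∷ P) ⊗ Q) s u ≡ coeff ([ t ] ⊗ Q) s u + coeff (P ⊗ Q) s u
  coeff-cons-⊗ t P Q s u = trans (cong (λ L → coeff (L ++ (P ⊗ Q)) s u) (sym (LP.++-identityʳ (map (t ·ₜ_) Q))))
                                 (coeff-++ ([ t ] ⊗ Q) (P ⊗ Q) s u)

  coeff-x-⊗ : ∀ Q s u → coeff (Xₚ ⊗ Q) s u ≡ prev (λ s → coeff Q s u) s
  coeff-x-⊗ []                zero    u = refl
  coeff-x-⊗ []                (suc s) u = refl
  coeff-x-⊗ ((d , a , b) ∷ Q) zero    u = trans (ZP.+-identityˡ _) (coeff-x-⊗ Q zero u)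
  coeff-x-⊗ ((d , a , b) ∷ Q) (suc s) u =
    cong₂ _+_ (cong (λ z → if (a ≡ᵇ s) ∧ (b ≡ᵇ u) then z else + 0) (ZP.*-identityˡ d)) (coeff-x-⊗ Q (suc s) u)

  coeff-y-⊗ : ∀ Q s u → coeff (Yₚ ⊗ Q) s u ≡ prev (λ u → coeff Q s u) u
  coeff-y-⊗ []                s zero    = refl
  coeff-y-⊗ []                s (suc u) = refl
  coeff-y-⊗ ((d , a , b) ∷ Q) s zero    = cong₂ _+_ (no-constant-term (a ≡ᵇ s)) (coeff-y-⊗ Q s zero)
    where
    no-constant-term : ∀ x → (if x ∧ false then + 1 * d else + 0) ≡ + 0
    no-constant-term true  = refl
    no-constant-term false = refl
  coeff-y-⊗ ((d , a , b) ∷ Q) s (suc u) =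
    cong₂ _+_ (cong (λ z → if (a ≡ᵇ s) ∧ (b ≡ᵇ u) then z else + 0) (ZP.*-identityˡ d)) (coeff-y-⊗ Q s (suc u))

  -- β a s: the coefficient of z^s in (z - 1)^a.
  β : ℕ → ℕ → ℤ
  β zero    zero    = + 1
  β zero    (suc s) = + 0
  β (suc a) s       = prev (β a) s - β a s

  prev-cong : ∀ {f g : ℕ → ℤ} → (∀ s → f s ≡ g s) → ∀ s → prev f s ≡ prev g s
  prev-cong f≡g zero    = refl
  prev-cong f≡g (suc s) = f≡g s

  coeff-x-1 : ∀ a s → coeff ((Xₚ ⊕ constₚ -[1+ 0 ]) ^ₚ a) s 0 ≡ β a s
  coeff-x-1 zero    zero    = refl
  coeff-x-1 zero    (suc s) = refl
  coeff-x-1 (suc a) s = begin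
    coeff ((Xₚ ⊕ constₚ -[1+ 0 ]) ⊗ Q) s 0
      ≡⟨ coeff-cons-⊗ (+ 1 , 1 , 0) (constₚ -[1+ 0 ]) Q s 0 ⟩
    coeff (Xₚ ⊗ Q) s 0 + coeff (scaleₚ -[1+ 0 ] Q) s 0
      ≡⟨ cong₂ _+_ (coeff-x-⊗ Q s 0) (coeff-scaleₚ -[1+ 0 ] Q s 0) ⟩
    prev (λ s → coeff Q s 0) s + -[1+ 0 ] * coeff Q s 0
      ≡⟨ cong₂ (λ x y → x + -[1+ 0 ] * y) (prev-cong (coeff-x-1 a) s) (coeff-x-1 a s) ⟩
    prev (β a) s + -[1+ 0 ] * β a s
      ≡⟨ minus (prev (β a) s) (β a s) ⟩
    β (suc a) s ∎
    where
    open ≡-Reasoning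
    Q = (Xₚ ⊕ constₚ -[1+ 0 ]) ^ₚ a
    minus : ∀ x y → x + -[1+ 0 ] * y ≡ x - y
    minus = solve-∀

  coeff-y-1 : ∀ b t → coeff ((Yₚ ⊕ constₚ -[1+ 0 ]) ^ₚ b) 0 t ≡ β b t
  coeff-y-1 zero    zero    = refl
  coeff-y-1 zero    (suc t) = refl
  coeff-y-1 (suc b) t = begin
    coeff ((Yₚ ⊕ constₚ -[1+ 0 ]) ⊗ Q) 0 t
      ≡⟨ coeff-cons-⊗ (+ 1 , 0 , 1) (constₚ -[1+ 0 ]) Q 0 t ⟩
    coeff (Yₚ ⊗ Q) 0 t + coeff (scaleₚ -[1+ 0 ] Q) 0 t
      ≡⟨ cong₂ _+_ (coeff-y-⊗ Q 0 t) (coeff-scaleₚ -[1+ 0 ] Q 0 t) ⟩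
    prev (λ t → coeff Q 0 t) t + -[1+ 0 ] * coeff Q 0 t
      ≡⟨ cong₂ (λ x y → x + -[1+ 0 ] * y) (prev-cong (coeff-y-1 b) t) (coeff-y-1 b t) ⟩
    prev (β b) t + -[1+ 0 ] * β b t
      ≡⟨ minus (prev (β b) t) (β b t) ⟩
    β (suc b) t ∎
    where
    open ≡-Reasoning
    Q = (Yₚ ⊕ constₚ -[1+ 0 ]) ^ₚ b
    minus : ∀ x y → x + -[1+ 0 ] * y ≡ x - y
    minus = solve-∀

  XOnly-x-1 : ∀ a → XOnly ((Xₚ ⊕ constₚ -[1+ 0 ]) ^ₚ a)
  XOnly-x-1 zero    = refl ∷ []
  XOnly-x-1 (suc a) = XOnly-⊗ {Xₚ ⊕ constₚ -[1+ 0 ]} (refl ∷ refl ∷ []) (XOnly-x-1 a)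

  YOnly-y-1 : ∀ b → YOnly ((Yₚ ⊕ constₚ -[1+ 0 ]) ^ₚ b)
  YOnly-y-1 zero    = refl ∷ []
  YOnly-y-1 (suc b) = YOnly-⊗ {Yₚ ⊕ constₚ -[1+ 0 ]} (refl ∷ refl ∷ []) (YOnly-y-1 b)

  -- Differentiating p times moves the coefficient of z^(i+p) to z^i, scaled by (i+p)_p;
  -- at the level of indicators: [a - p = i] · a_p = [a = i + p] · (i+p)_p.
  shift-indicator : ∀ a p i → ind (a ∸ p ≡ᵇ i) ℕ.* (a falling p) ≡ ind (a ≡ᵇ i ℕ.+ p) ℕ.* ((i ℕ.+ p) falling p)
  shift-indicator a p i with a ≡ᵇ i ℕ.+ p in a≡ᵇi+p
  ... | true rewrite NP.≡ᵇ⇒≡ a (i ℕ.+ p) (subst T (sym a≡ᵇi+p) tt)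
               | NP.m+n∸n≡m i p | ≡⇒≡ᵇ-true {i} refl = refl
  ... | false with a ∸ p ≡ᵇ i in a∸p≡ᵇi
  ...   | false = refl
  ...   | true with p ℕ.≤? a
  ...     | no  p≰a = trans (NP.*-identityˡ _) (falling-vanishes a p (NP.≰⇒> p≰a))
  ...     | yes p≤a = ⊥-elim (subst T a≡ᵇi+p (NP.≡⇒≡ᵇ a (i ℕ.+ p) a≡i+p))
    where
    a≡i+p : a ≡ i ℕ.+ p
    a≡i+p = trans (sym (NP.m∸n+n≡m p≤a)) (cong (ℕ._+ p) (NP.≡ᵇ⇒≡ (a ∸ p) i (subst T (sym a∸p≡ᵇi) tt)))

  coeff-∂ : ∀ p q P i j → coeff (∂ p q P) i j ≡
            + ((i ℕ.+ p) falling p) * + ((j ℕ.+ q) falling q) * coeff P (i ℕ.+ p) (j ℕ.+ q)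
  coeff-∂ p q P i j = begin
    coeff (∂ p q P) i j                                      ≡⟨ coeff-sum (∂ p q P) i j ⟩
    sumL (∂ p q P) (λ t → termCoeff t i j)                   ≡⟨ sumL-map _ P _ ⟩
    sumL P (λ { (c , a , b) → termCoeff (c * + (a falling p) * + (b falling q) , a ∸ p , b ∸ q) i j })
                                                             ≡⟨ sumL-cong P (λ { (c , a , b) → term c a b }) ⟩
    sumL P (λ t → α * β′ * termCoeff t (i ℕ.+ p) (j ℕ.+ q)) ≡⟨ sumL-scale P (α * β′) _ ⟩
    α * β′ * sumL P (λ t → termCoeff t (i ℕ.+ p) (j ℕ.+ q))  ≡⟨ cong (α * β′ *_) (sym (coeff-sum P (i ℕ.+ p) (j ℕ.+ q))) ⟩
    α * β′ * coeff P (i ℕ.+ p) (j ℕ.+ q)                     ∎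
    where
    open ≡-Reasoning
    α = + ((i ℕ.+ p) falling p)
    β′ = + ((j ℕ.+ q) falling q)
    shift-indicatorℤ : ∀ a p i → ⟦ a ∸ p ≡ᵇ i ⟧ * + (a falling p) ≡ ⟦ a ≡ᵇ i ℕ.+ p ⟧ * + ((i ℕ.+ p) falling p)
    shift-indicatorℤ a p i = trans (sym (ZP.pos-* (ind (a ∸ p ≡ᵇ i)) _))
                                   (trans (cong +_ (shift-indicator a p i)) (ZP.pos-* (ind (a ≡ᵇ i ℕ.+ p)) _))
    term : ∀ c a b → termCoeff (c * + (a falling p) * + (b falling q) , a ∸ p , b ∸ q) i j ≡
                     α * β′ * termCoeff (c , a , b) (i ℕ.+ p) (j ℕ.+ q)
    term c a b = begin
      ⟦ a ∸ p ≡ᵇ i ⟧ * ⟦ b ∸ q ≡ᵇ j ⟧ * (c * + (a falling p) * + (b falling q))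
        ≡⟨ regroup ⟦ a ∸ p ≡ᵇ i ⟧ ⟦ b ∸ q ≡ᵇ j ⟧ c (+ (a falling p)) (+ (b falling q)) ⟩
      (⟦ a ∸ p ≡ᵇ i ⟧ * + (a falling p)) * (⟦ b ∸ q ≡ᵇ j ⟧ * + (b falling q)) * c
        ≡⟨ cong₂ (λ x y → x * y * c) (shift-indicatorℤ a p i) (shift-indicatorℤ b q j) ⟩
      (⟦ a ≡ᵇ i ℕ.+ p ⟧ * α) * (⟦ b ≡ᵇ j ℕ.+ q ⟧ * β′) * c
        ≡⟨ regroup′ ⟦ a ≡ᵇ i ℕ.+ p ⟧ ⟦ b ≡ᵇ j ℕ.+ q ⟧ c α β′ ⟩
      α * β′ * (⟦ a ≡ᵇ i ℕ.+ p ⟧ * ⟦ b ≡ᵇ j ℕ.+ q ⟧ * c) ∎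
      where
      regroup : ∀ u v c x y → u * v * (c * x * y) ≡ (u * x) * (v * y) * c
      regroup = solve-∀
      regroup′ : ∀ u v c x y → (u * x) * (v * y) * c ≡ x * y * (u * v * c)
      regroup′ = solve-∀

  -- κ a p i: the coefficient of z^i in the p-th derivative of (z - 1)^a.
  κ : ℕ → ℕ → ℕ → ℤ
  κ a p i = + ((i ℕ.+ p) falling p) * β a (i ℕ.+ p)

  coeff-∂-term : ∀ p q a b i j →
    coeff (∂ p q (((Xₚ ⊕ constₚ -[1+ 0 ]) ^ₚ a) ⊗ ((Yₚ ⊕ constₚ -[1+ 0 ]) ^ₚ b))) i j ≡ κ a p i * κ b q j
  coeff-∂-term p q a b i j = begin
    coeff (∂ p q (Xa ⊗ Yb)) i j
      ≡⟨ coeff-∂ p q (Xa ⊗ Yb) i j ⟩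
    α * β′ * coeff (Xa ⊗ Yb) (i ℕ.+ p) (j ℕ.+ q)
      ≡⟨ cong (α * β′ *_) (coeff-separated (XOnly-x-1 a) (YOnly-y-1 b) _ _) ⟩
    α * β′ * (coeff Xa (i ℕ.+ p) 0 * coeff Yb 0 (j ℕ.+ q))
      ≡⟨ cong₂ (λ x y → α * β′ * (x * y)) (coeff-x-1 a _) (coeff-y-1 b _) ⟩
    α * β′ * (β a (i ℕ.+ p) * β b (j ℕ.+ q))
      ≡⟨ regroup α β′ (β a (i ℕ.+ p)) (β b (j ℕ.+ q)) ⟩
    κ a p i * κ b q j ∎
    where
    open ≡-Reasoning
    Xa = (Xₚ ⊕ constₚ -[1+ 0 ]) ^ₚ a
    Yb = (Yₚ ⊕ constₚ -[1+ 0 ]) ^ₚ b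
    α  = + ((i ℕ.+ p) falling p)
    β′ = + ((j ℕ.+ q) falling q)
    regroup : ∀ x y u v → x * y * (u * v) ≡ x * u * (y * v)
    regroup = solve-∀

  scaledPrev : (ℕ → ℤ) → ℕ → ℤ
  scaledPrev g zero    = + 0
  scaledPrev g (suc k) = + suc k * g k

  -- (z - 1)^(a+1) + (z - 1)^a = z (z - 1)^a, differentiated p times by Leibniz' rule.
  κ-rec : ∀ a p i → κ (suc a) p i + κ a p i ≡ prev (κ a p) i + scaledPrev (λ p′ → κ a p′ i) p
  κ-rec a p i = trans (z-times a p i) (derivative p i)
    where
    z-times : ∀ a p i → κ (suc a) p i + κ a p i ≡ + ((i ℕ.+ p) falling p) * prev (β a) (i ℕ.+ p)
    z-times a p i = cancel (+ ((i ℕ.+ p) falling p)) (prev (β a) (i ℕ.+ p)) (β a (i ℕ.+ p))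
      where
      cancel : ∀ f x y → f * (x - y) + f * y ≡ f * x
      cancel = solve-∀
    derivative : ∀ p i → + ((i ℕ.+ p) falling p) * prev (β a) (i ℕ.+ p) ≡ prev (κ a p) i + scaledPrev (λ p′ → κ a p′ i) p
    derivative zero    zero    = refl
    derivative zero    (suc i) = sym (ZP.+-identityʳ _)
    derivative (suc p) zero    = begin
      + ((suc p) falling (suc p)) * β a p                ≡⟨ cong (λ z → + z * β a p) diagonal ⟩
      + (suc p ℕ.* (p falling p)) * β a p                ≡⟨ cong (_* β a p) (ZP.pos-* (suc p) (p falling p)) ⟩
      + suc p * + (p falling p) * β a p                  ≡⟨ ZP.*-assoc (+ suc p) (+ (p falling p)) (β a p) ⟩
      + suc p * κ a p zero                               ≡⟨ sym (ZP.+-identityˡ _) ⟩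
      + 0 + + suc p * κ a p zero                         ∎
      where
      open ≡-Reasoning
      diagonal : (suc p) falling (suc p) ≡ suc p ℕ.* (p falling p)
      diagonal = trans (falling-pascal p p) (cong (ℕ._+ suc p ℕ.* (p falling p)) (falling-vanishes p (suc p) (NP.n<1+n p)))
    derivative (suc p) (suc i) = begin
      + ((suc m) falling (suc p)) * β a m
        ≡⟨ cong (λ z → + z * β a m) (falling-pascal m p) ⟩
      + (m falling (suc p) ℕ.+ suc p ℕ.* (m falling p)) * β a m
        ≡⟨ cong (_* β a m) (trans (ZP.pos-+ (m falling (suc p)) _) (cong (_+_ (+ (m falling (suc p)))) (ZP.pos-* (suc p) (m falling p)))) ⟩
      (+ (m falling (suc p)) + + suc p * + (m falling p)) * β a m
        ≡⟨ distribute (+ (m falling (suc p))) (+ suc p) (+ (m falling p)) (β a m) ⟩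
      κ a (suc p) i + + suc p * (+ (m falling p) * β a m)
        ≡⟨ cong (λ k → κ a (suc p) i + + suc p * (+ (k falling p) * β a k)) (NP.+-suc i p) ⟩
      κ a (suc p) i + + suc p * κ a p (suc i) ∎
      where
      open ≡-Reasoning
      m = i ℕ.+ suc p
      distribute : ∀ x s y b → (x + s * y) * b ≡ x * b + s * (y * b)
      distribute = solve-∀

  κ-base : ∀ p i → κ 0 p i ≡ ⟦ 0 ≡ᵇ p ⟧ * ⟦ 0 ≡ᵇ i ⟧
  κ-base zero    zero    = refl
  κ-base zero    (suc i) = refl
  κ-base (suc p) i       = trans (cong (λ k → + ((i ℕ.+ suc p) falling suc p) * β 0 k) (NP.+-suc i p))
                                 (ZP.*-zeroʳ (+ ((i ℕ.+ suc p) falling suc p)))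

module ActivityExpansion where

  open import Defs
  open Sums
  open Coefficients
  open Activities using (ε≡count; ι≡count)
  open Minors
  open import Data.Bool using (Bool; _∧_; if_then_else_)
  open import Data.Nat as ℕ using (ℕ; zero; suc; _≡ᵇ_; _!)
  import Data.Nat.Properties as NP
  open import Data.Integer using (ℤ; +_; -[1+_]; _+_; _*_)
  import Data.Integer.Properties as ZP
  open import Data.Integer.Tactic.RingSolver using (solve-∀)
  open import Data.Fin.Subset using (Subset; inside; outside)
  open import Data.Vec using ([]; _∷_; _∷ʳ_)
  open import Data.List using ([]; _∷_; [_]; map; filterᵇ)
  open import Data.Product using (_,_)
  open import Function using (_∘_)
  open import Relation.Binary.PropositionalEquality hiding ([_])

  Weight : Set
  Weight = Profile → ℤ

  -- A functional S sums a weight over a multiset of profiles; only linearity is used.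
  record Linear (S : Weight → ℤ) : Set where
    field
      S-cong : ∀ {f g} → (∀ d → f d ≡ g d) → S f ≡ S g
      S-+    : ∀ f g → S (λ d → f d + g d) ≡ S f + S g
      S-*    : ∀ c f → S (λ d → c * f d) ≡ c * S f

    S-zero : S (λ _ → + 0) ≡ + 0
    S-zero = trans (S-cong (λ _ → sym (ZP.*-zeroˡ (+ 0))))
                   (trans (S-* (+ 0) (λ _ → + 0)) (ZP.*-zeroˡ (S (λ _ → + 0))))

    S-prev : ∀ (F : ℕ → Weight) k → S (λ d → prev (λ k → F k d) k) ≡ prev (λ k → S (F k)) k
    S-prev F zero    = S-zero
    S-prev F (suc k) = refl

    S-scaledPrev : ∀ (F : ℕ → Weight) k → S (λ d → scaledPrev (λ k → F k d) k) ≡ scaledPrev (λ k → S (F k)) k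
    S-scaledPrev F zero    = S-zero
    S-scaledPrev F (suc k) = S-* (+ suc k) (F k)

  open Linear

  -- Coefficient of x^i y^j in ∂^{p+q}/∂x^p∂y^q of (x-1)^corank (y-1)^nullity.
  Φ : ℕ → ℕ → ℕ → ℕ → Weight
  Φ p q i j d = κ (corank d) p i * κ (nullity d) q j

  Ψ : ℕ → ℕ → ℕ → ℕ → Weight
  Ψ p q i j d = ⟦ corank d ≡ᵇ p ⟧ * ⟦ nullity d ≡ᵇ q ⟧ * ⟦ internal d ≡ᵇ i ⟧ * ⟦ external d ≡ᵇ j ⟧

  -- The theorem for the multiset of profiles summed by S.
  Good : (Weight → ℤ) → Set
  Good S = ∀ p q i j → S (Φ p q i j) ≡ + (p ! ℕ.* q !) * S (Ψ p q i j)

  good-ext : ∀ {S S′} → (∀ f → S f ≡ S′ f) → Good S → Good S′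
  good-ext S≡S′ good p q i j =
    trans (sym (S≡S′ (Φ p q i j))) (trans (good p q i j) (cong (_*_ (+ (p ! ℕ.* q !))) (S≡S′ (Ψ p q i j))))

  good-+ : ∀ {S₁ S₂} → Good S₁ → Good S₂ → Good (λ f → S₁ f + S₂ f)
  good-+ {S₁} {S₂} good₁ good₂ p q i j =
    trans (cong₂ _+_ (good₁ p q i j) (good₂ p q i j)) (sym (ZP.*-distribˡ-+ (+ (p ! ℕ.* q !)) _ _))

  -- The empty matroid: its single subset has profile (0, 0, 0, 0).
  good-point : Good (λ f → f ⟨ 0 , 0 , 0 , 0 ⟩)
  good-point p q i j = begin
    κ 0 p i * κ 0 q j                ≡⟨ cong₂ _*_ (κ-base p i) (κ-base q j) ⟩
    δp * δi * (δq * δj)              ≡⟨ regroup δp δi δq δj ⟩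
    δp * δq * (δi * δj)              ≡⟨ cong (_* (δi * δj)) (sym (factorials p q)) ⟩
    c * δp * δq * (δi * δj)          ≡⟨ regroup′ c δp δq δi δj ⟩
    c * Ψ p q i j ⟨ 0 , 0 , 0 , 0 ⟩  ∎
    where
    open ≡-Reasoning
    c  = + (p ! ℕ.* q !)
    δp = ⟦ 0 ≡ᵇ p ⟧
    δq = ⟦ 0 ≡ᵇ q ⟧
    δi = ⟦ 0 ≡ᵇ i ⟧
    δj = ⟦ 0 ≡ᵇ j ⟧
    factorials : ∀ p q → + (p ! ℕ.* q !) * ⟦ 0 ≡ᵇ p ⟧ * ⟦ 0 ≡ᵇ q ⟧ ≡ ⟦ 0 ≡ᵇ p ⟧ * ⟦ 0 ≡ᵇ q ⟧
    factorials zero    zero    = refl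
    factorials zero    (suc q) = ZP.*-zeroʳ (+ (0 ! ℕ.* suc q !) * + 1)
    factorials (suc p) q       = trans (cong (_* ⟦ 0 ≡ᵇ q ⟧) (ZP.*-zeroʳ (+ (suc p ! ℕ.* q !)))) (ZP.*-zeroˡ ⟦ 0 ≡ᵇ q ⟧)
    regroup : ∀ a b c d → a * b * (c * d) ≡ a * c * (b * d)
    regroup = solve-∀
    regroup′ : ∀ f a b c d → f * a * b * (c * d) ≡ f * (a * b * c * d)
    regroup′ = solve-∀

  prev-*ˡ : ∀ c (g : ℕ → ℤ) k → prev (λ k → c * g k) k ≡ c * prev g k
  prev-*ˡ c g zero    = sym (ZP.*-zeroʳ c)
  prev-*ˡ c g (suc k) = refl

  prev-*ʳ : ∀ (g : ℕ → ℤ) c k → prev g k * c ≡ prev (λ k → g k * c) k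
  prev-*ʳ g c zero    = ZP.*-zeroˡ c
  prev-*ʳ g c (suc k) = refl

  scaledPrev-*ʳ : ∀ (g : ℕ → ℤ) c k → scaledPrev g k * c ≡ scaledPrev (λ k → g k * c) k
  scaledPrev-*ʳ g c zero    = ZP.*-zeroˡ c
  scaledPrev-*ʳ g c (suc k) = ZP.*-assoc (+ suc k) (g k) c

  scaledPrev-cong : ∀ {f g : ℕ → ℤ} → (∀ k → f k ≡ g k) → ∀ k → scaledPrev f k ≡ scaledPrev g k
  scaledPrev-cong f≡g zero    = refl
  scaledPrev-cong f≡g (suc k) = cong (+ suc k *_) (f≡g k)

  scaledPrev-factorial : ∀ q (g : ℕ → ℤ) k → scaledPrev (λ k → + (k ! ℕ.* q !) * g k) k ≡ + (k ! ℕ.* q !) * prev g k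
  scaledPrev-factorial q g zero    = sym (ZP.*-zeroʳ (+ (0 ! ℕ.* q !)))
  scaledPrev-factorial q g (suc k) = begin
    + suc k * (+ (k ! ℕ.* q !) * g k)   ≡⟨ sym (ZP.*-assoc (+ suc k) (+ (k ! ℕ.* q !)) (g k)) ⟩
    + suc k * + (k ! ℕ.* q !) * g k     ≡⟨ cong (_* g k) (sym (ZP.pos-* (suc k) (k ! ℕ.* q !))) ⟩
    + (suc k ℕ.* (k ! ℕ.* q !)) * g k   ≡⟨ cong (λ m → + m * g k) (sym (NP.*-assoc (suc k) (k !) (q !))) ⟩
    + (suc k ! ℕ.* q !) * g k           ∎
    where open ≡-Reasoning

  -- A coloop raises the corank of sets avoiding it and the internal activity of sets containing it.
  Φ-coloop : ∀ p q i j d → Φ p q i j (+corank d) + Φ p q i j (+internal d) ≡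
                           prev (λ i′ → Φ p q i′ j d) i + scaledPrev (λ p′ → Φ p′ q i j d) p
  Φ-coloop p q i j d = begin
    κ (suc c) p i * K + κ c p i * K
      ≡⟨ sym (ZP.*-distribʳ-+ K (κ (suc c) p i) (κ c p i)) ⟩
    (κ (suc c) p i + κ c p i) * K
      ≡⟨ cong (_* K) (κ-rec c p i) ⟩
    (prev (κ c p) i + scaledPrev (λ p′ → κ c p′ i) p) * K
      ≡⟨ ZP.*-distribʳ-+ K (prev (κ c p) i) (scaledPrev (λ p′ → κ c p′ i) p) ⟩
    prev (κ c p) i * K + scaledPrev (λ p′ → κ c p′ i) p * K
      ≡⟨ cong₂ _+_ (prev-*ʳ (κ c p) K i) (scaledPrev-*ʳ (λ p′ → κ c p′ i) K p) ⟩
    prev (λ i′ → Φ p q i′ j d) i + scaledPrev (λ p′ → Φ p′ q i j d) p ∎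
    where
    open ≡-Reasoning
    c = corank d
    K = κ (nullity d) q j

  Ψ-coloop : ∀ p q i j d → Ψ p q i j (+corank d) + Ψ p q i j (+internal d) ≡
                           prev (λ i′ → Ψ p q i′ j d) i + prev (λ p′ → Ψ p′ q i j d) p
  Ψ-coloop p q i j d =
    trans (ZP.+-comm (Ψ p q i j (+corank d)) (Ψ p q i j (+internal d))) (cong₂ _+_ (internal-part i) (corank-part p))
    where
    L = ⟦ nullity d ≡ᵇ q ⟧
    corank-part : ∀ p → Ψ p q i j (+corank d) ≡ prev (λ p′ → Ψ p′ q i j d) p
    corank-part zero    = vanish L ⟦ internal d ≡ᵇ i ⟧ ⟦ external d ≡ᵇ j ⟧
      where
      vanish : ∀ a b c → + 0 * a * b * c ≡ + 0
      vanish = solve-∀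
    corank-part (suc p) = refl
    internal-part : ∀ i → Ψ p q i j (+internal d) ≡ prev (λ i′ → Ψ p q i′ j d) i
    internal-part zero    = vanish ⟦ corank d ≡ᵇ p ⟧ L ⟦ external d ≡ᵇ j ⟧
      where
      vanish : ∀ a b c → a * b * + 0 * c ≡ + 0
      vanish = solve-∀
    internal-part (suc i) = refl

  -- Adding a coloop preserves the theorem: by Φ-coloop and Ψ-coloop both sides satisfy the
  -- same recursion, which the induction hypothesis closes using k · (k-1)! = k!.
  good-coloop : ∀ {S} → Linear S → Good S → Good (λ f → S (λ d → f (+corank d) + f (+internal d)))
  good-coloop {S} lin good p q i j = begin
    S (λ d → Φ p q i j (+corank d) + Φ p q i j (+internal d))
      ≡⟨ S-cong lin (Φ-coloop p q i j) ⟩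
    S (λ d → prev (λ i′ → Φ p q i′ j d) i + scaledPrev (λ p′ → Φ p′ q i j d) p)
      ≡⟨ S-+ lin _ _ ⟩
    S (λ d → prev (λ i′ → Φ p q i′ j d) i) + S (λ d → scaledPrev (λ p′ → Φ p′ q i j d) p)
      ≡⟨ cong₂ _+_ (S-prev lin (λ i′ → Φ p q i′ j) i) (S-scaledPrev lin (λ p′ → Φ p′ q i j) p) ⟩
    prev (λ i′ → S (Φ p q i′ j)) i + scaledPrev (λ p′ → S (Φ p′ q i j)) p
      ≡⟨ cong₂ _+_ (prev-cong (λ i′ → good p q i′ j) i) (scaledPrev-cong (λ p′ → good p′ q i j) p) ⟩
    prev (λ i′ → c * S (Ψ p q i′ j)) i + scaledPrev (λ p′ → + (p′ ! ℕ.* q !) * S (Ψ p′ q i j)) p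
      ≡⟨ cong₂ _+_ (prev-*ˡ c (λ i′ → S (Ψ p q i′ j)) i) (scaledPrev-factorial q (λ p′ → S (Ψ p′ q i j)) p) ⟩
    c * prev (λ i′ → S (Ψ p q i′ j)) i + c * prev (λ p′ → S (Ψ p′ q i j)) p
      ≡⟨ sym (ZP.*-distribˡ-+ c _ _) ⟩
    c * (prev (λ i′ → S (Ψ p q i′ j)) i + prev (λ p′ → S (Ψ p′ q i j)) p)
      ≡⟨ cong (c *_) (sym (cong₂ _+_ (S-prev lin (λ i′ → Ψ p q i′ j) i) (S-prev lin (λ p′ → Ψ p′ q i j) p))) ⟩
    c * (S (λ d → prev (λ i′ → Ψ p q i′ j d) i) + S (λ d → prev (λ p′ → Ψ p′ q i j d) p))
      ≡⟨ cong (c *_) (sym (S-+ lin _ _)) ⟩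
    c * S (λ d → prev (λ i′ → Ψ p q i′ j d) i + prev (λ p′ → Ψ p′ q i j d) p)
      ≡⟨ cong (c *_) (sym (S-cong lin (Ψ-coloop p q i j))) ⟩
    c * S (λ d → Ψ p q i j (+corank d) + Ψ p q i j (+internal d)) ∎
    where
    open ≡-Reasoning
    c = + (p ! ℕ.* q !)

  swap : Profile → Profile
  swap d = ⟨ nullity d , corank d , external d , internal d ⟩

  linear-swap : ∀ {S} → Linear S → Linear (λ f → S (f ∘ swap))
  linear-swap lin = record
    { S-cong = λ f≡g → S-cong lin (f≡g ∘ swap)
    ; S-+    = λ f g → S-+ lin (f ∘ swap) (g ∘ swap)
    ; S-*    = λ c f → S-* lin c (f ∘ swap)
    }

  good-swap : ∀ {S} → Linear S → Good S → Good (λ f → S (f ∘ swap))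
  good-swap {S} lin good p q i j = begin
    S (Φ p q i j ∘ swap)                   ≡⟨ S-cong lin (λ d → ZP.*-comm (κ (nullity d) p i) _) ⟩
    S (Φ q p j i)                          ≡⟨ good q p j i ⟩
    + (q ! ℕ.* p !) * S (Ψ q p j i)        ≡⟨ cong₂ _*_ (cong +_ (NP.*-comm (q !) (p !))) (S-cong lin Ψ-swap) ⟩
    + (p ! ℕ.* q !) * S (Ψ p q i j ∘ swap) ∎
    where
    open ≡-Reasoning
    Ψ-swap : ∀ d → Ψ q p j i d ≡ Ψ p q i j (swap d)
    Ψ-swap d = reorder ⟦ corank d ≡ᵇ q ⟧ ⟦ nullity d ≡ᵇ p ⟧ ⟦ internal d ≡ᵇ j ⟧ ⟦ external d ≡ᵇ i ⟧
      where
      reorder : ∀ a b c e → a * b * c * e ≡ b * a * e * c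
      reorder = solve-∀

  -- Adding a loop raises the external activity of sets avoiding it and the nullity of
  -- sets containing it: the swap of adding a coloop.
  good-loop : ∀ {S} → Linear S → Good S → Good (λ f → S (λ d → f (+external d) + f (+nullity d)))
  good-loop {S} lin good =
    good-ext (λ f → S-cong lin (λ d → ZP.+-comm (f (+nullity d)) (f (+external d))))
             (good-swap (linear-coloop (linear-swap lin)) (good-coloop (linear-swap lin) (good-swap lin good)))
    where
    linear-coloop : ∀ {S} → Linear S → Linear (λ f → S (λ d → f (+corank d) + f (+internal d)))
    linear-coloop {S} lin = record
      { S-cong = λ f≡g → S-cong lin (λ d → cong₂ _+_ (f≡g (+corank d)) (f≡g (+internal d)))
      ; S-+    = λ f g → trans (S-cong lin (λ d → shuffle (f (+corank d)) (g (+corank d)) (f (+internal d)) (g (+internal d))))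
                               (S-+ lin _ _)
      ; S-*    = λ c f → trans (S-cong lin (λ d → sym (ZP.*-distribˡ-+ c (f (+corank d)) (f (+internal d)))))
                               (S-* lin c _)
      }
      where
      shuffle : ∀ a b c d → a + b + (c + d) ≡ a + c + (b + d)
      shuffle = solve-∀

  over : ∀ {n} → Matroid n → Weight → ℤ
  over {n} M f = sumL (allSubsets n) (f ∘ profile M)

  linear-over : ∀ {n} (M : Matroid n) → Linear (over M)
  linear-over {n} M = record
    { S-cong = λ f≡g → sumL-cong (allSubsets n) (f≡g ∘ profile M)
    ; S-+    = λ f g → sumL-+ (allSubsets n) (f ∘ profile M) (g ∘ profile M)
    ; S-*    = λ c f → sumL-scale (allSubsets n) c (f ∘ profile M)
    }

  sum-allSubsets-∷ʳ : ∀ n (g : Subset (suc n) → ℤ) →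
                      sumL (allSubsets (suc n)) g ≡ sumL (allSubsets n) (λ A → g (A ∷ʳ outside) + g (A ∷ʳ inside))
  sum-allSubsets-∷ʳ zero    g = sym (ZP.+-assoc (g (outside ∷ [])) (g (inside ∷ [])) (+ 0))
  sum-allSubsets-∷ʳ (suc n) g = begin
    sumL (allSubsets (suc (suc n))) g
      ≡⟨ split-first (suc n) g ⟩
    sumL (allSubsets (suc n)) (g ∘ (outside ∷_)) + sumL (allSubsets (suc n)) (g ∘ (inside ∷_))
      ≡⟨ cong₂ _+_ (sum-allSubsets-∷ʳ n (g ∘ (outside ∷_))) (sum-allSubsets-∷ʳ n (g ∘ (inside ∷_))) ⟩
    sumL (allSubsets n) (λ A → g (outside ∷ (A ∷ʳ outside)) + g (outside ∷ (A ∷ʳ inside))) +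
    sumL (allSubsets n) (λ A → g (inside ∷ (A ∷ʳ outside)) + g (inside ∷ (A ∷ʳ inside)))
      ≡⟨ sym (split-first n (λ A → g (A ∷ʳ outside) + g (A ∷ʳ inside))) ⟩
    sumL (allSubsets (suc n)) (λ A → g (A ∷ʳ outside) + g (A ∷ʳ inside)) ∎
    where
    open ≡-Reasoning
    split-first : ∀ n (g : Subset (suc n) → ℤ) →
                  sumL (allSubsets (suc n)) g ≡ sumL (allSubsets n) (g ∘ (outside ∷_)) + sumL (allSubsets n) (g ∘ (inside ∷_))
    split-first n g = trans (sumL-++ (map (outside ∷_) (allSubsets n)) _ g)
                            (cong₂ _+_ (sumL-map _ (allSubsets n) g) (sumL-map _ (allSubsets n) g))

  over-last-element : ∀ {n} (M : Matroid (suc n)) {g h : Subset n → Profile} →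
                      (∀ A → profile M (A ∷ʳ outside) ≡ g A) → (∀ A → profile M (A ∷ʳ inside) ≡ h A) →
                      ∀ f → sumL (allSubsets n) (λ A → f (g A) + f (h A)) ≡ over M f
  over-last-element {n} M outside≡ inside≡ f =
    sym (trans (sum-allSubsets-∷ʳ n (f ∘ profile M))
               (sumL-cong (allSubsets n) (λ A → cong₂ _+_ (cong f (outside≡ A)) (cong f (inside≡ A)))))

  good-over : ∀ n (M : Matroid n) → Good (over M)
  good-over zero    M = good-ext single-subset good-point
    where
    single-subset : ∀ f → f ⟨ 0 , 0 , 0 , 0 ⟩ ≡ over M f
    single-subset f = trans (cong f (cong₂ (λ c l → ⟨ c , l , 0 , 0 ⟩) (sym (NP.n∸n≡0 (r M []))) (sym (NP.0∸n≡0 (r M [])))))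
                            (sym (ZP.+-identityʳ _))
  good-over (suc n) M with classify M
  ... | loop D outside≡ inside≡ =
    good-ext (over-last-element M outside≡ inside≡) (good-loop (linear-over D) (good-over n D))
  ... | coloop D outside≡ inside≡ =
    good-ext (over-last-element M outside≡ inside≡) (good-coloop (linear-over D) (good-over n D))
  ... | ordinary D C outside≡ inside≡ =
    good-ext (λ f → trans (sym (sumL-+ (allSubsets n) (f ∘ profile D) (f ∘ profile C)))
                          (over-last-element M outside≡ inside≡ f))
             (good-+ {over D} {over C} (good-over n D) (good-over n C))

  coeff-∂-tutte : ∀ {n} (M : Matroid n) p q i j → coeff (∂ p q (tutte M)) i j ≡ over M (Φ p q i j)
  coeff-∂-tutte {n} M p q i j = begin
    coeff (∂ p q (tutte M)) i j
      ≡⟨ cong (λ P → coeff P i j) (∂-sumₚ p q term (allSubsets n)) ⟩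
    coeff (sumₚ (map (∂ p q ∘ term) (allSubsets n))) i j
      ≡⟨ coeff-sumₚ (∂ p q ∘ term) (allSubsets n) i j ⟩
    sumL (allSubsets n) (λ A → coeff (∂ p q (term A)) i j)
      ≡⟨ sumL-cong (allSubsets n) (λ A → coeff-∂-term p q (cr M A) (nl M A) i j) ⟩
    over M (Φ p q i j) ∎
    where
    open ≡-Reasoning
    term : Subset _ → Poly
    term A = ((Xₚ ⊕ constₚ -[1+ 0 ]) ^ₚ cr M A) ⊗ ((Yₚ ⊕ constₚ -[1+ 0 ]) ^ₚ nl M A)

  coeff-activitySum : ∀ {n} (M : Matroid n) p q i j → coeff (activitySum M p q) i j ≡ over M (Ψ p q i j)
  coeff-activitySum {n} M p q i j = begin
    coeff (activitySum M p q) i j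
      ≡⟨ coeff-sumₚ monomial (filterᵇ selected (allSubsets n)) i j ⟩
    sumL (filterᵇ selected (allSubsets n)) (λ A → coeff (monomial A) i j)
      ≡⟨ sumL-filter selected (allSubsets n) _ ⟩
    sumL (allSubsets n) (λ A → if selected A then coeff (monomial A) i j else + 0)
      ≡⟨ sumL-cong (allSubsets n) indicator ⟩
    over M (Ψ p q i j) ∎
    where
    open ≡-Reasoning
    monomial : Subset n → Poly
    monomial A = [ (+ 1 , ι M A , ε M A) ]
    selected : Subset n → Bool
    selected A = (cr M A ≡ᵇ p) ∧ (nl M A ≡ᵇ q)
    indicator : ∀ A → (if selected A then coeff (monomial A) i j else + 0) ≡ Ψ p q i j (profile M A)
    indicator A = begin
      (if selected A then coeff (monomial A) i j else + 0)
        ≡⟨ ⟦∧⟧-if (cr M A ≡ᵇ p) (nl M A ≡ᵇ q) _ ⟩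
      δc * δl * ((if (ι M A ≡ᵇ i) ∧ (ε M A ≡ᵇ j) then + 1 else + 0) + + 0)
        ≡⟨ cong (λ x → δc * δl * (x + + 0)) (⟦∧⟧-if (ι M A ≡ᵇ i) (ε M A ≡ᵇ j) (+ 1)) ⟩
      δc * δl * (⟦ ι M A ≡ᵇ i ⟧ * ⟦ ε M A ≡ᵇ j ⟧ * + 1 + + 0)
        ≡⟨ cong₂ (λ x y → δc * δl * (⟦ x ≡ᵇ i ⟧ * ⟦ y ≡ᵇ j ⟧ * + 1 + + 0)) (ι≡count M A) (ε≡count M A) ⟩
      δc * δl * (δx * δy * + 1 + + 0)
        ≡⟨ flatten δc δl δx δy ⟩
      Ψ p q i j (profile M A) ∎
      where
      δc = ⟦ cr M A ≡ᵇ p ⟧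
      δl = ⟦ nl M A ≡ᵇ q ⟧
      δx = ⟦ internal (profile M A) ≡ᵇ i ⟧
      δy = ⟦ external (profile M A) ≡ᵇ j ⟧
      flatten : ∀ a b c d → a * b * (c * d * + 1 + + 0) ≡ a * b * c * d
      flatten = solve-∀

open import Defs
open import Data.Nat using (ℕ; _*_; _!)
open import Data.Integer using (+_)
import Data.Integer as ℤ
open import Relation.Binary.PropositionalEquality
open Coefficients using (coeff-scaleₚ)
open ActivityExpansion using (over; Φ; Ψ; good-over; coeff-∂-tutte; coeff-activitySum)

theorem1 : ∀ {n} (M : Matroid n) (p q : ℕ) →
    ∂ p q (tutte M) ≈ₚ scaleₚ (+ ((p !) * (q !))) (activitySum M p q)
theorem1 {n} M p q i j = begin
  coeff (∂ p q (tutte M)) i j                              ≡⟨ coeff-∂-tutte M p q i j ⟩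
  over M (Φ p q i j)                                       ≡⟨ good-over n M p q i j ⟩
  + (p ! * q !) ℤ.* over M (Ψ p q i j)                     ≡⟨ cong (ℤ._*_ (+ (p ! * q !))) (sym (coeff-activitySum M p q i j)) ⟩
  + (p ! * q !) ℤ.* coeff (activitySum M p q) i j          ≡⟨ sym (coeff-scaleₚ (+ (p ! * q !)) (activitySum M p q) i j) ⟩
  coeff (scaleₚ (+ (p ! * q !)) (activitySum M p q)) i j  ∎
  where open ≡-Reasoning
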